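{- For every $n\ge1$ and partition $\lambda\subseteq\delta_n$, the normalized volume of $\mathcal{P}_\lambda(n)$ is $\mathrm{vol}(\mathcal{P}_\lambda(n))=e\big((\delta_n\setminus\lambda)^*\big)$, and its Ehrhart polynomial is $L_{\mathcal{P}_\lambda(n)}(t)=\Omega_{(\delta_n\setminus\lambda)^*}(t+1)$.
   Context: $\mathcal{A}(n)$ is the set of real $n\times n$ matrices $(a_{ij})$ with $0\le\sum_{i=1}^{i'}a_{ij}\le1$ for all $1\le i',j\le n$, $0\le\sum_{j=1}^{j'}a_{ij}\le1$ for all $1\le j',i\le n$, and all full row and column sums equal to $1$. $\delta_n=(n-1,\dots,1)$ is identified with $\{(i,j):1\le i<j\le n\}$; a partition $\lambda=(\lambda_1,\dots,\lambda_k)\subseteq\delta_n$ is identified with $\{(i,j):1\le i\le k,\ n-\lambda_i+1\le j\le n\}$. $\mathcal{P}_\lambda(n)=\{(a_{ij})\in\mathcal{A}(n):a_{ij}=0 \text{ whenever } i-j\ge2 \text{ and whenever }(i,j)\in\lambda\}$ (an integral polytope). The poset $(\delta_n\setminus\lambda)^*$ has elements $p_{ij}$, $(i,j)\in\delta_n\setminus\lambda$, with $p_{ij}\le p_{i'j'}$ iff $i\ge i'$ and $j\le j'$. $e(P)$ is the number of linear extensions of a poset $P$; $\Omega_P(m)$ is the number of order-preserving maps $P\to\{1,\dots,m\}$. For an integral polytope $\mathcal{P}$, $L_{\mathcal{P}}(t)$ counts lattice points of $t\mathcal{P}$, and the normalized volume is $\dim(\mathcal{P})!$ times the leading coefficient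 of $L_{\mathcal{P}}$. -}

module Defs where

open import Data.Nat using (ℕ; zero; suc; _+_; _∸_; _≤_; _<_; _!)
open import Data.Integer as ℤ using (ℤ; +_; 0ℤ)
open import Data.Rational as ℚ using (ℚ; _/_)
open import Data.Fin using (Fin; toℕ)
open import Data.Vec using (Vec; []; _∷_; last)
open import Data.List using (List; []; _∷_; length)
open import Data.List.Relation.Unary.All using (All)
open import Data.List.Relation.Unary.Linked using (Linked)
open import Data.Product using (Σ; _×_; _,_)
open import Relation.Binary.PropositionalEquality using (_≡_; _≢_)
open import Function using (_∘_)

Card : {A : Set} → (A → A → Set) → (A → Set) → ℕ → Set
Card {A} _≈_ S k =
  Σ (Fin k → A) λ f →
    (∀ i → S (f i)) ×
    (∀ i j → f i ≈ f j → i ≡ j) ×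
    (∀ a → S a → Σ (Fin k) λ i → f i ≈ a)

-- Partitions λ ⊆ δ_n.  A partition is a list of positive parts
-- λ_1 ≥ λ_2 ≥ … ≥ λ_k.  part λ i is the (i+1)-st part (0-indexed i),
-- and 0 beyond the length.

part : List ℕ → ℕ → ℕ
part []       _       = 0
part (x ∷ xs) zero    = x
part (x ∷ xs) (suc i) = part xs i

-- λ ⊆ δ_n : row i' (1-indexed, i' = i+1) has λ_{i'} ≤ n - i'.
IsPartitionIn : ℕ → List ℕ → Set
IsPartitionIn n λ′ =
  All (1 ≤_) λ′ ×
  Linked (λ a b → b ≤ a) λ′ ×
  (∀ i → i < length λ′ → part λ′ i + suc i ≤ n)

-- Indices below are 0-indexed: Fin n entry i corresponds to row i+1.
-- Cell (i,j) (1-indexed (i+1,j+1)) lies in λ iff n - λ_{i+1} + 1 ≤ j+1,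
-- i.e. n ∸ λ_{i+1} ≤ j (for rows beyond the length, λ_{i+1} = 0 and the
-- condition n ≤ j never holds).
InPart : (n : ℕ) → List ℕ → Fin n → Fin n → Set
InPart n λ′ i j = n ∸ part λ′ (toℕ i) ≤ toℕ j

-- Cell (i,j) belongs to δ_n ∖ λ : i < j and (i,j) ∉ λ (negation of InPart,
-- written positively).
InPoset : (n : ℕ) → List ℕ → Fin n → Fin n → Set
InPoset n λ′ i j = toℕ i < toℕ j × toℕ j < n ∸ part λ′ (toℕ i)

PLeq : {n : ℕ} → Fin n → Fin n → Fin n → Fin n → Set
PLeq i j i′ j′ = toℕ i′ ≤ toℕ i × toℕ j ≤ toℕ j′

psum : {n : ℕ} → (Fin n → ℤ) → ℕ → ℤ
psum {zero}  f m       = 0ℤ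
psum {suc n} f zero    = 0ℤ
psum {suc n} f (suc m) = f Fin.zero ℤ.+ psum (f ∘ Fin.suc) m
  where import Data.Fin as Fin

IntMatrix : ℕ → Set
IntMatrix n = Fin n → Fin n → ℤ

_≈M_ : {n : ℕ} → IntMatrix n → IntMatrix n → Set
a ≈M b = ∀ i j → a i j ≡ b i j

-- a ∈ t·P_λ(n) ∩ ℤ^{n×n}: the defining (in)equalities of A(n) scaled by t,
-- together with the vanishing conditions.
InDilatedPolytope : (n : ℕ) → List ℕ → ℕ → IntMatrix n → Set
InDilatedPolytope n λ′ t a =
  (∀ j m → 0ℤ ℤ.≤ psum (λ i → a i j) m × psum (λ i → a i j) m ℤ.≤ + t) ×
  (∀ i m → 0ℤ ℤ.≤ psum (λ j → a i j) m × psum (λ j → a i j) m ℤ.≤ + t) ×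
  (∀ j → psum (λ i → a i j) n ≡ + t) ×
  (∀ i → psum (λ j → a i j) n ≡ + t) ×
  (∀ i j → toℕ j + 2 ≤ toℕ i → a i j ≡ 0ℤ) ×
  (∀ i j → toℕ i < toℕ j → InPart n λ′ i j → a i j ≡ 0ℤ)

EhrhartValue : (n : ℕ) → List ℕ → ℕ → ℕ → Set
EhrhartValue n λ′ t k = Card _≈M_ (InDilatedPolytope n λ′ t) k

-- Maps on the poset (δ_n ∖ λ)^*, represented as functions on all cells,
-- identified when they agree on the poset's elements.

CellMap : ℕ → Set
CellMap n = Fin n → Fin n → ℕ

_≈on_ : {n : ℕ} → List ℕ → CellMap n → CellMap n → Set
_≈on_ {n} λ′ g h = ∀ i j → InPoset n λ′ i j → g i j ≡ h i j

OrderPreserving : (n : ℕ) → List ℕ → CellMap n → Set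
OrderPreserving n λ′ g =
  ∀ i j i′ j′ → InPoset n λ′ i j → InPoset n λ′ i′ j′ →
    PLeq i j i′ j′ → g i j ≤ g i′ j′

OrderPresInto : (n : ℕ) → List ℕ → ℕ → CellMap n → Set
OrderPresInto n λ′ m g =
  (∀ i j → InPoset n λ′ i j → 1 ≤ g i j × g i j ≤ m) ×
  OrderPreserving n λ′ g

OmegaValue : (n : ℕ) → List ℕ → ℕ → ℕ → Set
OmegaValue n λ′ m k = Card (_≈on_ λ′) (OrderPresInto n λ′ m) k

PosetSize : (n : ℕ) → List ℕ → ℕ → Set
PosetSize n λ′ N =
  Card {Fin n × Fin n} _≡_ (λ { (i , j) → InPoset n λ′ i j }) N

-- linear extensions: order-preserving bijections onto {1,…,N}, N = |P|
-- (injective order-preserving maps into {1,…,N}).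
LinearExtension : (n : ℕ) → List ℕ → ℕ → CellMap n → Set
LinearExtension n λ′ N g =
  OrderPresInto n λ′ N g ×
  (∀ i j i′ j′ → InPoset n λ′ i j → InPoset n λ′ i′ j′ →
     g i j ≡ g i′ j′ → (i ≡ i′ × j ≡ j′))

NumLinExt : (n : ℕ) → List ℕ → ℕ → Set
NumLinExt n λ′ e =
  Σ ℕ λ N → PosetSize n λ′ N × Card (_≈on_ λ′) (LinearExtension n λ′ N) e

-- Polynomials over ℚ as coefficient vectors c_0, …, c_d.

ℕtoℚ : ℕ → ℚ
ℕtoℚ k = (+ k) / 1

evalPoly : {d : ℕ} → Vec ℚ d → ℚ → ℚ
evalPoly []       x = ℚ.0ℚ
evalPoly (c ∷ cs) x = c ℚ.+ x ℚ.* evalPoly cs x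

-- The normalized volume of P_λ(n) is v: L_{P_λ(n)}(t) agrees with a
-- polynomial of degree d (nonzero leading coefficient c_d), and
-- v = d! · c_d.  (The degree of the Ehrhart polynomial is dim P.)
NormalizedVolume : (n : ℕ) → List ℕ → ℕ → Set
NormalizedVolume n λ′ v =
  Σ ℕ λ d → Σ (Vec ℚ (suc d)) λ c →
    (last c ≢ ℚ.0ℚ) ×
    (∀ t k → EhrhartValue n λ′ t k → ℕtoℚ k ≡ evalPoly c (ℕtoℚ t)) ×
    (ℕtoℚ v ≡ ℕtoℚ (d !) ℚ.* last c)

-- A lattice point a of t·P_λ(n) is determined by its corner sums. Normalised by the columns
-- left of the diagonal, they form a height array G(i, c) with values in [0, t], weakly
-- increasing along rows and decreasing down columns, 0 left of the diagonal and t from the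
-- end of row i of δ_n ∖ λ on; on the cells of δ_n ∖ λ, G + 1 is exactly an order-preserving
-- map (δ_n ∖ λ)* → [t + 1], so L(t) = Ω(t + 1).
--
-- Removing the top level set of an order-preserving map gives Stanley's expansion
-- Ω(m) = Σ_s e_s (m choose s), where e_s counts order-preserving surjections onto [s];
-- e_s = 0 for s > N = |P| and e_N = e(P). Since (t + 1 choose s) is a polynomial in t of
-- degree s with leading coefficient 1/s!, L has degree N and leading coefficient e(P)/N!.
module Submission where

open import Data.Nat using (ℕ)
open import Data.List using (List)
open import Relation.Binary using (DecidableEquality)
open import Relation.Nullary using (Dec)
open import Defs using (IsPartitionIn)

module Cardinality where

  open import Defs using (Card)
  open import Data.Nat using (_≤_; s≤s)
  open import Data.Nat.Properties using (≤-antisym)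
  open import Data.Fin using (Fin; zero; suc; _<_)
  open import Data.Fin.Properties using (<-cmp; injective⇒≤)
  open import Data.List using (List; _∷_; length; lookup)
  import Data.List.Relation.Unary.All as All
  open import Data.List.Relation.Unary.Any using (Any; index)
  open import Data.List.Relation.Unary.Any.Properties using (lookup-index)
  open import Data.List.Relation.Unary.AllPairs using (AllPairs; _∷_)
  open import Data.List.Membership.Propositional using (_∈_)
  open import Data.List.Membership.Propositional.Properties using (∈-lookup)
  open import Data.Product using (_,_; proj₁; proj₂)
  open import Relation.Binary using (Rel; IsEquivalence; Symmetric; tri<; tri≈; tri>)
  open import Relation.Binary.PropositionalEquality as ≡ using (_≡_; subst)
  open import Relation.Nullary using (¬_)
  open import Relation.Unary using (Pred)
  open import Data.Empty using (⊥-elim)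
  open import Level using (0ℓ)

  module _ {A : Set} {_≈_ : Rel A 0ℓ} where

    lookup-distinct : ∀ {xs : List A} → AllPairs (λ x y → ¬ x ≈ y) xs →
      ∀ {i j} → i < j → ¬ lookup xs i ≈ lookup xs j
    lookup-distinct {_ ∷ _} (x≉ ∷ _) {zero} {suc j} _ = All.lookup x≉ (∈-lookup j)
    lookup-distinct {_ ∷ _} (_ ∷ distinct) {suc i} {suc j} (s≤s i<j) =
      lookup-distinct distinct i<j

    card-fromList : {S : Pred A 0ℓ} → Symmetric _≈_ → (xs : List A) →
      (∀ {x} → x ∈ xs → S x) → AllPairs (λ x y → ¬ x ≈ y) xs →
      (∀ a → S a → Any (_≈ a) xs) → Card _≈_ S (length xs)
    card-fromList ≈-sym xs sound distinct complete =
      lookup xs , (λ i → sound (∈-lookup i)) , injective ,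
      λ a Sa → index (complete a Sa) , lookup-index (complete a Sa)
      where
        injective : ∀ i j → lookup xs i ≈ lookup xs j → i ≡ j
        injective i j xᵢ≈xⱼ with <-cmp i j
        ... | tri< i<j _ _ = ⊥-elim (lookup-distinct distinct i<j xᵢ≈xⱼ)
        ... | tri≈ _ i≡j _ = i≡j
        ... | tri> _ _ j<i = ⊥-elim (lookup-distinct distinct j<i (≈-sym xᵢ≈xⱼ))

    card-unique : {S : Pred A 0ℓ} → IsEquivalence _≈_ →
      ∀ {k k′} → Card _≈_ S k → Card _≈_ S k′ → k ≡ k′
    card-unique {S} isEq c c′ = ≤-antisym (card-≤ c c′) (card-≤ c′ c)
      where
        open IsEquivalence isEq using () renaming (sym to ≈-sym; trans to ≈-trans)
        card-≤ : ∀ {k k′} → Card _≈_ S k → Card _≈_ S k′ → k ≤ k′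
        card-≤ (f , Sf , f-inj , _) (g , _ , _ , g-onto) = injective⇒≤ h-injective
          where
            h = λ i → proj₁ (g-onto (f i) (Sf i))
            gh≈f = λ i → proj₂ (g-onto (f i) (Sf i))
            h-injective : ∀ {i j} → h i ≡ h j → i ≡ j
            h-injective {i} {j} hᵢ≡hⱼ =
              f-inj i j (≈-trans (≈-sym (gh≈f i)) (subst (λ k → g k ≈ f j) (≡.sym hᵢ≡hⱼ) (gh≈f j)))

  card-transfer : {A B : Set} {_≈₁_ : Rel A 0ℓ} {_≈₂_ : Rel B 0ℓ}
    {S : Pred A 0ℓ} {T : Pred B 0ℓ} →
    (∀ {x y z} → x ≈₂ y → y ≈₂ z → x ≈₂ z) →
    (φ : A → B) (ψ : B → A) →
    (∀ a → S a → T (φ a)) → (∀ b → T b → S (ψ b)) →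
    (∀ b → T b → φ (ψ b) ≈₂ b) →
    (∀ a a′ → S a → S a′ → φ a ≈₂ φ a′ → a ≈₁ a′) →
    (∀ a a′ → S a → S a′ → a ≈₁ a′ → φ a ≈₂ φ a′) →
    ∀ {k} → Card _≈₁_ S k → Card _≈₂_ T k
  card-transfer ≈₂-trans φ ψ φ-S ψ-T φψ≈id φ-reflects φ-cong (f , Sf , f-inj , f-onto) =
    (λ i → φ (f i)) , (λ i → φ-S (f i) (Sf i)) ,
    (λ i j φfᵢ≈φfⱼ → f-inj i j (φ-reflects (f i) (f j) (Sf i) (Sf j) φfᵢ≈φfⱼ)) ,
    λ b Tb → let (i , fᵢ≈ψb) = f-onto (ψ b) (ψ-T b Tb) in
      i , ≈₂-trans (φ-cong (f i) (ψ b) (Sf i) (ψ-T b Tb) fᵢ≈ψb) (φψ≈id b Tb)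

module NatSums where

  open import Data.Nat using (ℕ; zero; suc; _+_; _*_; _≤_)
  open import Data.Nat.Properties using (+-comm; *-distribʳ-+; *-distribˡ-+; ≤-trans; m≤m+n; m≤n+m)
  open import Data.Nat.Combinatorics using (_C_; nCk+nC[k+1]≡[n+1]C[k+1])
  open import Data.Nat.ListAction using (sum)
  open import Data.Nat.ListAction.Properties using (sum-++)
  open import Data.Nat.Solver using (module +-*-Solver)
  open import Data.List using (List; []; _∷_; map; applyUpTo; [_]; _∷ʳ_)
  open import Data.List.Properties using (applyUpTo-∷ʳ)
  open import Data.List.Relation.Unary.All using (All; []; _∷_)
  open import Data.List.Relation.Unary.Any using (Any; here; there)
  open import Relation.Binary.PropositionalEquality using (_≡_; refl; sym; trans; cong; cong₂; module ≡-Reasoning)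
  open +-*-Solver using (solve; _:+_; _:=_; con)

  sumUpTo : ℕ → (ℕ → ℕ) → ℕ
  sumUpTo K f = sum (applyUpTo f K)

  infixl 10 sumUpTo
  syntax sumUpTo K (λ s → e) = ∑[ s < K ] e

  sumUpTo-cong : ∀ K {f g : ℕ → ℕ} → (∀ s → f s ≡ g s) → sumUpTo K f ≡ sumUpTo K g
  sumUpTo-cong zero    f≗g = refl
  sumUpTo-cong (suc K) f≗g = cong₂ _+_ (f≗g 0) (sumUpTo-cong K (λ s → f≗g (suc s)))

  sumUpTo-+ : ∀ K (f g : ℕ → ℕ) → sumUpTo K f + sumUpTo K g ≡ ∑[ s < K ] (f s + g s)
  sumUpTo-+ zero    f g = refl
  sumUpTo-+ (suc K) f g = trans
    (solve 4 (λ a b c d → (a :+ b) :+ (c :+ d) := (a :+ c) :+ (b :+ d)) refl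
      (f 0) (sumUpTo K (λ s → f (suc s))) (g 0) (sumUpTo K (λ s → g (suc s))))
    (cong (f 0 + g 0 +_) (sumUpTo-+ K (λ s → f (suc s)) (λ s → g (suc s))))

  sumUpTo-suc : ∀ K (f : ℕ → ℕ) → sumUpTo (suc K) f ≡ sumUpTo K f + f K
  sumUpTo-suc K f = begin
    sum (applyUpTo f (suc K))         ≡⟨ cong sum (applyUpTo-∷ʳ f K) ⟨
    sum (applyUpTo f K ∷ʳ f K)        ≡⟨ sum-++ (applyUpTo f K) [ f K ] ⟩
    sumUpTo K f + (f K + 0)           ≡⟨ cong (sumUpTo K f +_) (+-comm (f K) 0) ⟩
    sumUpTo K f + f K                 ∎
    where open ≡-Reasoning

  sumUpTo-zero : ∀ K → ∑[ s < K ] 0 ≡ 0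
  sumUpTo-zero zero    = refl
  sumUpTo-zero (suc K) = sumUpTo-zero K

  sum-map-sumUpTo : {A : Set} (K : ℕ) (F : A → ℕ → ℕ) (xs : List A) →
    sum (map (λ x → sumUpTo K (F x)) xs) ≡ ∑[ s < K ] (sum (map (λ x → F x s) xs))
  sum-map-sumUpTo K F []       = sym (sumUpTo-zero K)
  sum-map-sumUpTo K F (x ∷ xs) =
    trans (cong (sumUpTo K (F x) +_) (sum-map-sumUpTo K F xs)) (sumUpTo-+ K (F x) _)

  sum-map-*ʳ : {A : Set} (f : A → ℕ) (c : ℕ) (xs : List A) →
    sum (map (λ x → f x * c) xs) ≡ sum (map f xs) * c
  sum-map-*ʳ f c []       = refl
  sum-map-*ʳ f c (x ∷ xs) =
    trans (cong (f x * c +_) (sum-map-*ʳ f c xs)) (sym (*-distribʳ-+ c (f x) _))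

  sum-map-zero : {A : Set} {f : A → ℕ} {xs : List A} → All (λ x → f x ≡ 0) xs → sum (map f xs) ≡ 0
  sum-map-zero []            = refl
  sum-map-zero (fx≡0 ∷ fxs≡0) = cong₂ _+_ fx≡0 (sum-map-zero fxs≡0)

  sum-map-≥ : {A : Set} {f : A → ℕ} {xs : List A} {k : ℕ} → Any (λ x → k ≤ f x) xs → k ≤ sum (map f xs)
  sum-map-≥ {f = f} {x ∷ xs} (here k≤fx) = ≤-trans k≤fx (m≤m+n (f x) _)
  sum-map-≥ {f = f} {x ∷ xs} (there k≤) = ≤-trans (sum-map-≥ k≤) (m≤n+m _ (f x))

  sumUpTo-pascal : ∀ K (a : ℕ → ℕ) m → a (suc K) ≡ 0 →
    ∑[ s < suc K ] (a s * (m C s)) + ∑[ s < suc K ] (a (suc s) * (m C s)) ≡ ∑[ s < suc K ] (a s * (suc m C s))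
  sumUpTo-pascal K a m aK≡0 = begin
    (a 0 * 1 + T) + ∑[ s < suc K ] (a (suc s) * (m C s))
      ≡⟨ cong ((a 0 * 1 + T) +_) (sumUpTo-suc K (λ s → a (suc s) * (m C s))) ⟩
    (a 0 * 1 + T) + (U + a (suc K) * (m C K))
      ≡⟨ cong (λ x → (a 0 * 1 + T) + (U + x * (m C K))) aK≡0 ⟩
    (a 0 * 1 + T) + (U + 0)
      ≡⟨ solve 3 (λ x t u → (x :+ t) :+ (u :+ con 0) := x :+ (u :+ t)) refl (a 0 * 1) T U ⟩
    a 0 * 1 + (U + T)
      ≡⟨ cong (a 0 * 1 +_) (sumUpTo-+ K (λ s → a (suc s) * (m C s)) (λ s → a (suc s) * (m C suc s))) ⟩
    a 0 * 1 + ∑[ s < K ] (a (suc s) * (m C s) + a (suc s) * (m C suc s))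
      ≡⟨ cong (a 0 * 1 +_) (sumUpTo-cong K λ s → trans
           (sym (*-distribˡ-+ (a (suc s)) (m C s) (m C suc s)))
           (cong (a (suc s) *_) (nCk+nC[k+1]≡[n+1]C[k+1] m s))) ⟩
    a 0 * 1 + ∑[ s < K ] (a (suc s) * (suc m C suc s))
      ∎
    where
      open ≡-Reasoning
      T = ∑[ s < K ] (a (suc s) * (m C suc s))
      U = ∑[ s < K ] (a (suc s) * (m C s))

module Splits {E : Set} where

  open import Data.List using (List; []; _∷_; _++_; map; filter)
  open import Data.List.Relation.Unary.All as All using (All)
  import Data.List.Relation.Unary.All.Properties as All
  open import Data.List.Relation.Unary.Any using (here; there)
  open import Data.List.Relation.Unary.AllPairs as AllPairs using (AllPairs; []; _∷_)
  import Data.List.Relation.Unary.AllPairs.Properties as AllPairs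
  open import Data.List.Relation.Unary.Unique.Propositional {A = E} using (Unique)
  open import Data.List.Relation.Ternary.Interleaving.Propositional {A = E}
    using (Interleaving; []; consˡ; consʳ; swap)
  open import Data.List.Membership.Propositional using (_∈_; _∉_)
  open import Data.List.Membership.Propositional.Properties
    using (∈-++⁻; ∈-++⁺ˡ; ∈-++⁺ʳ; ∈-map⁺; ∈-map⁻)
  open import Data.Product using (∃; _×_; _,_; map₁; map₂)
  open import Data.Sum as Sum using (_⊎_; inj₁; inj₂)
  open import Data.Empty using (⊥)
  open import Function using (_∘_)
  open import Relation.Binary.PropositionalEquality using (refl)
  open import Relation.Nullary using (yes; no)
  open import Relation.Nullary.Decidable using (¬?)
  open import Relation.Unary using (Pred; Decidable)
  open import Level using (0ℓ)

  Split : Set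
  Split = List E × List E

  splits : List E → List Split
  splits []       = ([] , []) ∷ []
  splits (x ∷ xs) = map (map₁ (x ∷_)) (splits xs) ++ map (map₂ (x ∷_)) (splits xs)

  ∈-splits⁺ : ∀ {A B xs} → Interleaving A B xs → (A , B) ∈ splits xs
  ∈-splits⁺ []                  = here refl
  ∈-splits⁺ (consˡ sp)          = ∈-++⁺ˡ (∈-map⁺ (map₁ _) (∈-splits⁺ sp))
  ∈-splits⁺ {xs = _ ∷ xs} (consʳ sp) =
    ∈-++⁺ʳ (map (map₁ _) (splits xs)) (∈-map⁺ (map₂ _) (∈-splits⁺ sp))

  ∈-splits⁻ : ∀ {A B} xs → (A , B) ∈ splits xs → Interleaving A B xs
  ∈-splits⁻ []       (here refl) = []
  ∈-splits⁻ (x ∷ xs) A,B∈ with ∈-++⁻ (map (map₁ (x ∷_)) (splits xs)) A,B∈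
  ... | inj₁ ∈left  with ∈-map⁻ (map₁ (x ∷_)) ∈left
  ...   | _ , ∈xs , refl = consˡ (∈-splits⁻ xs ∈xs)
  ∈-splits⁻ (x ∷ xs) A,B∈ | inj₂ ∈right with ∈-map⁻ (map₂ (x ∷_)) ∈right
  ...   | _ , ∈xs , refl = consʳ (∈-splits⁻ xs ∈xs)

  interleaving-filter : {P : Pred E 0ℓ} (P? : Decidable P) (xs : List E) →
    Interleaving (filter (¬? ∘ P?) xs) (filter P? xs) xs
  interleaving-filter P? []       = []
  interleaving-filter P? (x ∷ xs) with P? x
  ... | yes _ = consʳ (interleaving-filter P? xs)
  ... | no  _ = consˡ (interleaving-filter P? xs)

  Separated : Split → Split → Set
  Separated (A₁ , B₁) (A₂ , B₂) = ∃ λ c → (c ∈ B₁ × c ∈ A₂) ⊎ (c ∈ A₁ × c ∈ B₂)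

  splits-separated : (xs : List E) → AllPairs Separated (splits xs)
  splits-separated []       = All.[] ∷ []
  splits-separated (x ∷ xs) =
    AllPairs.++⁺ (AllPairs.map⁺ (AllPairs.map consˡ-separated (splits-separated xs)))
                 (AllPairs.map⁺ (AllPairs.map consʳ-separated (splits-separated xs)))
                 (All.map⁺ (All.tabulate λ _ → All.map⁺ (All.tabulate λ _ →
                   x , inj₂ (here refl , here refl))))
    where
      consˡ-separated : ∀ {s₁ s₂} → Separated s₁ s₂ → Separated (map₁ (x ∷_) s₁) (map₁ (x ∷_) s₂)
      consˡ-separated (c , inj₁ (b , a)) = c , inj₁ (b , there a)
      consˡ-separated (c , inj₂ (a , b)) = c , inj₂ (there a , b)
      consʳ-separated : ∀ {s₁ s₂} → Separated s₁ s₂ → Separated (map₂ (x ∷_) s₁) (map₂ (x ∷_) s₂)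
      consʳ-separated (c , inj₁ (b , a)) = c , inj₁ (there b , a)
      consʳ-separated (c , inj₂ (a , b)) = c , inj₂ (a , there b)

  interleaving-∈ˡ : ∀ {A B xs} → Interleaving A B xs → ∀ {c} → c ∈ A → c ∈ xs
  interleaving-∈ˡ (consˡ sp) (here c≡)  = here c≡
  interleaving-∈ˡ (consˡ sp) (there c∈) = there (interleaving-∈ˡ sp c∈)
  interleaving-∈ˡ (consʳ sp) c∈         = there (interleaving-∈ˡ sp c∈)

  interleaving-∈ʳ : ∀ {A B xs} → Interleaving A B xs → ∀ {c} → c ∈ B → c ∈ xs
  interleaving-∈ʳ = interleaving-∈ˡ ∘ swap

  interleaving-∈⁻ : ∀ {A B xs} → Interleaving A B xs → ∀ {c} → c ∈ xs → c ∈ A ⊎ c ∈ B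
  interleaving-∈⁻ (consˡ sp) (here c≡)  = inj₁ (here c≡)
  interleaving-∈⁻ (consʳ sp) (here c≡)  = inj₂ (here c≡)
  interleaving-∈⁻ (consˡ sp) (there c∈) = Sum.map₁ there (interleaving-∈⁻ sp c∈)
  interleaving-∈⁻ (consʳ sp) (there c∈) = Sum.map₂ there (interleaving-∈⁻ sp c∈)

  ∉-Unique : ∀ {x xs} → Unique (x ∷ xs) → x ∉ xs
  ∉-Unique (x≢ ∷ _) x∈ = All.lookup x≢ x∈ refl

  interleaving-disjoint : ∀ {A B xs} → Unique xs → Interleaving A B xs → ∀ {c} → c ∈ A → c ∈ B → ⊥
  interleaving-disjoint u!       (consˡ sp) (here refl) c∈B = ∉-Unique u! (interleaving-∈ʳ sp c∈B)
  interleaving-disjoint (_ ∷ u!) (consˡ sp) (there c∈A) c∈B = interleaving-disjoint u! sp c∈A c∈B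
  interleaving-disjoint u!       (consʳ sp) c∈A (here refl) = ∉-Unique u! (interleaving-∈ˡ sp c∈A)
  interleaving-disjoint (_ ∷ u!) (consʳ sp) c∈A (there c∈B) = interleaving-disjoint u! sp c∈A c∈B

  interleaving-uniqueˡ : ∀ {A B xs} → Unique xs → Interleaving A B xs → Unique A
  interleaving-uniqueˡ _               []         = []
  interleaving-uniqueˡ u!@(_ ∷ u!′) (consˡ sp) =
    All.¬Any⇒All¬ _ (∉-Unique u! ∘ interleaving-∈ˡ sp) ∷ interleaving-uniqueˡ u!′ sp
  interleaving-uniqueˡ (_ ∷ u!)        (consʳ sp) = interleaving-uniqueˡ u! sp

  interleaving-uniqueʳ : ∀ {A B xs} → Unique xs → Interleaving A B xs → Unique B
  interleaving-uniqueʳ u! = interleaving-uniqueˡ u! ∘ swap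

module OrderPreservingMaps {E : Set} (_≟_ : DecidableEquality E)
  {_⊑_ : E → E → Set} (_⊑?_ : ∀ x y → Dec (x ⊑ y)) where

  open import Data.Nat as ℕ using (ℕ; zero; suc; _+_; _*_; _≤_; _<_; z≤n; s≤s; _<?_)
  open import Data.Nat.Properties hiding (_≟_)
  open import Data.Nat.ListAction using (sum)
  open import Data.List using (List; []; _∷_; _++_; length; map; filter; concatMap; applyUpTo)
  open import Data.List.Properties using (length-++; length-map; map-cong-local; filter-notAll; length-applyUpTo)
  open import Data.Nat.Combinatorics using (_C_)
  open import Data.List.Relation.Unary.All as All using (All; all?)
  import Data.List.Relation.Unary.All.Properties as All
  open import Data.List.Relation.Unary.Any as Any using (Any; here; there; any?)
  open import Data.List.Relation.Unary.AllPairs as AllPairs using (AllPairs; []; _∷_)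
  import Data.List.Relation.Unary.AllPairs.Properties as AllPairs
  open import Data.List.Relation.Unary.Unique.Propositional {A = E} using (Unique)
  open import Data.List.Relation.Ternary.Interleaving.Propositional {A = E} using (Interleaving)
  open import Data.List.Relation.Ternary.Interleaving.Properties using (interleave-length)
  open import Data.List.Membership.Propositional using (_∈_; _∉_; find; lose)
  open import Data.List.Membership.Propositional.Properties
    using (∈-filter⁺; ∈-filter⁻; ∈-map⁺; ∈-map⁻; ∈-concatMap⁺; ∈-concatMap⁻; ∈-length; ∈-++⁻; ∈-applyUpTo⁺)
  open import Data.List.Membership.DecPropositional _≟_ using (_∈?_)
  open import Data.Product using (∃; ∃₂; _×_; _,_; proj₁; proj₂)
  open import Data.Sum using (inj₁; inj₂)
  open import Data.Empty using (⊥-elim)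
  open import Function using (_∘_; id)
  import Data.List.Relation.Unary.Any.Properties as Any
  open import Relation.Binary.PropositionalEquality
  open import Relation.Nullary using (¬_; Dec; yes; no)
  open import Relation.Nullary.Decidable using (_×-dec_; _→-dec_; ¬?)
  open import Relation.Binary using (Transitive; Antisymmetric)
  open Splits {E}
  open NatSums
  open Cardinality using (card-fromList)
  open import Defs using (Card)

  Labelling : Set
  Labelling = E → ℕ

  _≈[_]_ : Labelling → List E → Labelling → Set
  g ≈[ Q ] h = ∀ {c} → c ∈ Q → g c ≡ h c

  ≈-sym : ∀ {Q g h} → g ≈[ Q ] h → h ≈[ Q ] g
  ≈-sym g≈h c∈ = sym (g≈h c∈)

  Bounded : List E → ℕ → Labelling → Set
  Bounded Q m g = ∀ {c} → c ∈ Q → 1 ≤ g c × g c ≤ m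

  Monotone : List E → Labelling → Set
  Monotone Q g = ∀ {c c′} → c ∈ Q → c′ ∈ Q → c ⊑ c′ → g c ≤ g c′

  OrderPreserving : List E → ℕ → Labelling → Set
  OrderPreserving Q m g = Bounded Q m g × Monotone Q g

  Attains : List E → ℕ → Labelling → Set
  Attains Q v g = Any (λ c → g c ≡ v) Q

  Surjective : List E → ℕ → Labelling → Set
  Surjective Q s g = ∀ v → 1 ≤ v → v ≤ s → Attains Q v g

  Distinct : List E → List Labelling → Set
  Distinct Q = AllPairs (λ g h → ¬ g ≈[ Q ] h)

  UpSet : List E → List E → Set
  UpSet Q B = All (λ c → All (λ c′ → c ⊑ c′ → c′ ∈ B) Q) B

  IsTopSplit : List E → Split → Set
  IsTopSplit Q (A , B) = UpSet Q B × 0 < length B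

  isTopSplit? : ∀ Q sp → Dec (IsTopSplit Q sp)
  isTopSplit? Q (A , B) =
    all? (λ c → all? (λ c′ → (c ⊑? c′) →-dec (c′ ∈? B)) Q) B ×-dec (0 <? length B)

  topSplits : List E → List Split
  topSplits Q = filter (isTopSplit? Q) (splits Q)

  ∈-topSplits⁻ : ∀ {Q A B} → (A , B) ∈ topSplits Q → Interleaving A B Q × IsTopSplit Q (A , B)
  ∈-topSplits⁻ {Q} AB∈ = let AB∈splits , top = ∈-filter⁻ (isTopSplit? Q) AB∈ in ∈-splits⁻ Q AB∈splits , top

  ∈-topSplits⁺ : ∀ {Q A B} → Interleaving A B Q → IsTopSplit Q (A , B) → (A , B) ∈ topSplits Q
  ∈-topSplits⁺ {Q} sp top = ∈-filter⁺ (isTopSplit? Q) (∈-splits⁺ sp) top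

  topSplit-shorter : ∀ {Q A B} → (A , B) ∈ topSplits Q → length A < length Q
  topSplit-shorter {Q} {A} {B} AB∈ with ∈-topSplits⁻ {Q} AB∈
  ... | sp , _ , 0<|B| = begin-strict
    length A              ≡⟨ +-identityʳ (length A) ⟨
    length A + 0          <⟨ +-monoʳ-< (length A) 0<|B| ⟩
    length A + length B   ≡⟨ interleave-length {as = Q} sp ⟨
    length Q              ∎
    where open ≤-Reasoning

  _[_≔_] : Labelling → List E → ℕ → Labelling
  (h [ B ≔ v ]) c with c ∈? B
  ... | yes _ = v
  ... | no  _ = h c

  [≔]-∈ : ∀ {h B v c} → c ∈ B → (h [ B ≔ v ]) c ≡ v
  [≔]-∈ {B = B} {c = c} c∈B with c ∈? B
  ... | yes _   = refl
  ... | no  c∉B = ⊥-elim (c∉B c∈B)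

  [≔]-∉ : ∀ {h B v c} → c ∉ B → (h [ B ≔ v ]) c ≡ h c
  [≔]-∉ {B = B} {c = c} c∉B with c ∈? B
  ... | yes c∈B = ⊥-elim (c∉B c∈B)
  ... | no  _   = refl

  [≔]-orderPreserving : ∀ {Q A B m h} → Interleaving A B Q → UpSet Q B →
    OrderPreserving A m h → OrderPreserving Q (suc m) (h [ B ≔ suc m ])
  [≔]-orderPreserving {Q} {A} {B} {m} {h} sp up (bounded , monotone) = bounded′ , monotone′
    where
      bounded′ : Bounded Q (suc m) (h [ B ≔ suc m ])
      bounded′ {c} c∈Q with c ∈? B | interleaving-∈⁻ sp c∈Q
      ... | yes _   | _       = s≤s z≤n , ≤-refl
      ... | no  c∉B | inj₂ c∈B = ⊥-elim (c∉B c∈B)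
      ... | no  _   | inj₁ c∈A = proj₁ (bounded c∈A) , m≤n⇒m≤1+n (proj₂ (bounded c∈A))
      monotone′ : Monotone Q (h [ B ≔ suc m ])
      monotone′ {c} {c′} c∈Q c′∈Q c⊑c′ with c′ ∈? B
      ... | yes _    = proj₂ (bounded′ c∈Q)
      ... | no c′∉B with c ∈? B
      ...   | yes c∈B = ⊥-elim (c′∉B (All.lookup (All.lookup up c∈B) c′∈Q c⊑c′))
      ...   | no  c∉B with interleaving-∈⁻ sp c∈Q | interleaving-∈⁻ sp c′∈Q
      ...     | inj₂ c∈B | _         = ⊥-elim (c∉B c∈B)
      ...     | inj₁ _   | inj₂ c′∈B = ⊥-elim (c′∉B c′∈B)
      ...     | inj₁ c∈A | inj₁ c′∈A = monotone c∈A c′∈A c⊑c′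

  raiseOn : ℕ → (List E → List Labelling) → Split → List Labelling
  raiseOn v F (A , B) = map (_[ B ≔ v ]) (F A)

  extendTop : ℕ → (List E → List Labelling) → List E → List Labelling
  extendTop v F Q = concatMap (raiseOn v F) (topSplits Q)

  ∈-extendTop⁻ : ∀ {v F Q g} → g ∈ extendTop v F Q →
    ∃₂ λ A B → ∃ λ h → (A , B) ∈ topSplits Q × h ∈ F A × g ≡ h [ B ≔ v ]
  ∈-extendTop⁻ {v} {F} g∈ with find (∈-concatMap⁻ (raiseOn v F) g∈)
  ... | (A , B) , AB∈ , g∈map with ∈-map⁻ (_[ B ≔ v ]) g∈map
  ...   | h , h∈ , g≡ = A , B , h , AB∈ , h∈ , g≡

  ∈-extendTop⁺ : ∀ {v F Q A B h} → (A , B) ∈ topSplits Q → h ∈ F A → h [ B ≔ v ] ∈ extendTop v F Q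
  ∈-extendTop⁺ {v} {F} {B = B} AB∈ h∈ =
    ∈-concatMap⁺ (raiseOn v F) (lose AB∈ (∈-map⁺ (_[ B ≔ v ]) h∈))

  extendTop-sound : ∀ {m F Q g} → (∀ {A h} → h ∈ F A → OrderPreserving A m h) →
    g ∈ extendTop (suc m) F Q → OrderPreserving Q (suc m) g
  extendTop-sound {m} {F} {Q} F-sound g∈ with ∈-extendTop⁻ {suc m} {F} {Q} g∈
  ... | _ , _ , _ , AB∈ , h∈ , refl =
    let sp , up , _ = ∈-topSplits⁻ {Q} AB∈ in [≔]-orderPreserving sp up (F-sound h∈)

  extendTop-attains : ∀ {v F Q g} → g ∈ extendTop v F Q → Attains Q v g
  extendTop-attains {v} {F} {Q} g∈ with ∈-extendTop⁻ {v} {F} {Q} g∈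
  ... | _ , []    , _ , AB∈ , _ , refl = ⊥-elim (n≮0 (proj₂ (proj₂ (∈-topSplits⁻ {Q} AB∈))))
  ... | _ , b ∷ _ , _ , AB∈ , _ , refl =
    lose (interleaving-∈ʳ (proj₁ (∈-topSplits⁻ {Q} AB∈)) (here refl)) ([≔]-∈ (here refl))

  extendTop-complete : ∀ {m F Q g} → OrderPreserving Q (suc m) g → Attains Q (suc m) g →
    (∀ {A B} → Interleaving A B Q → (∀ {c} → c ∈ A → g c ≢ suc m) →
       (∀ {c} → c ∈ B → g c ≡ suc m) → Any (_≈[ A ] g) (F A)) →
    Any (_≈[ Q ] g) (extendTop (suc m) F Q)
  extendTop-complete {m} {F} {Q} {g} (bounded , monotone) attains complete-below =
    let h , h∈ , h≈g = find (complete-below sp below top) in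
    lose (∈-extendTop⁺ {F = F} {Q} (∈-topSplits⁺ {Q} sp (upSet , nonEmpty)) h∈) (agrees h≈g)
    where
      isTop? = λ c → g c ℕ.≟ suc m
      A = filter (¬? ∘ isTop?) Q
      B = filter isTop? Q
      sp : Interleaving A B Q
      sp = interleaving-filter isTop? Q
      below : ∀ {c} → c ∈ A → g c ≢ suc m
      below c∈A = proj₂ (∈-filter⁻ (¬? ∘ isTop?) {xs = Q} c∈A)
      top : ∀ {c} → c ∈ B → g c ≡ suc m
      top c∈B = proj₂ (∈-filter⁻ isTop? {xs = Q} c∈B)
      upSet : UpSet Q B
      upSet = All.tabulate λ c∈B → All.tabulate λ c′∈Q c⊑c′ →
        let c∈Q = proj₁ (∈-filter⁻ isTop? c∈B) in
        ∈-filter⁺ isTop? c′∈Q (≤-antisym (proj₂ (bounded c′∈Q))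
          (subst (_≤ g _) (top c∈B) (monotone c∈Q c′∈Q c⊑c′)))
      nonEmpty : 0 < length B
      nonEmpty = let c , c∈Q , gc≡ = find attains in ∈-length (∈-filter⁺ isTop? c∈Q gc≡)
      agrees : ∀ {h} → h ≈[ A ] g → (h [ B ≔ suc m ]) ≈[ Q ] g
      agrees {h} h≈g {c} c∈Q with c ∈? B | interleaving-∈⁻ sp c∈Q
      ... | yes c∈B | _        = sym (top c∈B)
      ... | no  c∉B | inj₂ c∈B = ⊥-elim (c∉B c∈B)
      ... | no  _   | inj₁ c∈A = h≈g c∈A

  allPairs-with : ∀ {A : Set} {P : A → Set} {R : A → A → Set} {xs} →
    All P xs → AllPairs R xs → AllPairs (λ x y → P x × P y × R x y) xs
  allPairs-with All.[]       []         = []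
  allPairs-with (px All.∷ pxs) (Rx ∷ Rxs) =
    All.zipWith (λ (py , Rxy) → px , py , Rxy) (pxs , Rx) ∷ allPairs-with pxs Rxs

  extendTop-distinct : ∀ {m F Q} → Unique Q →
    (∀ {A} → Unique A → Distinct A (F A)) → (∀ {A h} → h ∈ F A → Bounded A m h) →
    Distinct Q (extendTop (suc m) F Q)
  extendTop-distinct {m} {F} {Q} Q! F-distinct F-bounded =
    AllPairs.concat⁺ (All.map⁺ (All.tabulate within))
      (AllPairs.map⁺ (AllPairs.map across
        (allPairs-with (All.tabulate (λ AB∈ → proj₁ (∈-topSplits⁻ {Q} AB∈)))
          (AllPairs.filter⁺ (isTopSplit? Q) (splits-separated Q)))))
    where
      v = suc m
      within : ∀ {sp} → sp ∈ topSplits Q → Distinct Q (raiseOn v F sp)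
      within {A , B} AB∈ = AllPairs.map⁺ (AllPairs.map unraise (F-distinct (interleaving-uniqueˡ Q! sp)))
        where
          sp = proj₁ (∈-topSplits⁻ {Q} AB∈)
          unraise : ∀ {h h′} → ¬ h ≈[ A ] h′ → ¬ (h [ B ≔ v ]) ≈[ Q ] (h′ [ B ≔ v ])
          unraise h≉h′ eq = h≉h′ λ c∈A →
            let c∉B = interleaving-disjoint Q! sp c∈A in
            trans (sym ([≔]-∉ c∉B)) (trans (eq (interleaving-∈ˡ sp c∈A)) ([≔]-∉ c∉B))
      top≢below : ∀ {A B h₁ B₁ h₂ c} → Interleaving A B Q → c ∈ B₁ → c ∈ A → h₂ ∈ F A →
        (h₁ [ B₁ ≔ v ]) c ≢ (h₂ [ B ≔ v ]) c
      top≢below sp c∈B₁ c∈A h₂∈ eq = 1+n≰n (begin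
        suc m          ≡⟨ trans (sym ([≔]-∈ c∈B₁)) (trans eq ([≔]-∉ (interleaving-disjoint Q! sp c∈A))) ⟩
        _              ≤⟨ proj₂ (F-bounded h₂∈ c∈A) ⟩
        m              ∎)
        where open ≤-Reasoning
      across : ∀ {sp₁ sp₂} →
        Interleaving (proj₁ sp₁) (proj₂ sp₁) Q × Interleaving (proj₁ sp₂) (proj₂ sp₂) Q × Separated sp₁ sp₂ →
        All (λ g → All (λ g′ → ¬ g ≈[ Q ] g′) (raiseOn v F sp₂)) (raiseOn v F sp₁)
      across (sp₁ , sp₂ , c , inj₁ (c∈B₁ , c∈A₂)) =
        All.map⁺ (All.tabulate λ _ → All.map⁺ (All.tabulate λ h₂∈ eq →
          top≢below sp₂ c∈B₁ c∈A₂ h₂∈ (eq (interleaving-∈ʳ sp₁ c∈B₁))))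
      across (sp₁ , sp₂ , c , inj₂ (c∈A₁ , c∈B₂)) =
        All.map⁺ (All.tabulate λ h₁∈ → All.map⁺ (All.tabulate λ _ eq →
          top≢below sp₁ c∈B₂ c∈A₁ h₁∈ (sym (eq (interleaving-∈ʳ sp₂ c∈B₂)))))

  length-extendTop : ∀ v F Q →
    length (extendTop v F Q) ≡ sum (map (λ (A , _) → length (F A)) (topSplits Q))
  length-extendTop v F Q = go (topSplits Q)
    where
      go : ∀ sps → length (concatMap (raiseOn v F) sps) ≡ sum (map (λ (A , _) → length (F A)) sps)
      go []              = refl
      go ((A , B) ∷ sps) = trans (length-++ (map (_[ B ≔ v ]) (F A)))
        (cong₂ _+_ (length-map (_[ B ≔ v ]) (F A)) (go sps))

  labellingsInto0 : List E → List Labelling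
  labellingsInto0 []      = (λ _ → 0) ∷ []
  labellingsInto0 (_ ∷ _) = []

  orderPreservingMaps : List E → ℕ → List Labelling
  orderPreservingMaps Q zero    = labellingsInto0 Q
  orderPreservingMaps Q (suc m) =
    orderPreservingMaps Q m ++ extendTop (suc m) (λ A → orderPreservingMaps A m) Q

  surjections : List E → ℕ → List Labelling
  surjections Q zero    = labellingsInto0 Q
  surjections Q (suc s) = extendTop (suc s) (λ A → surjections A s) Q

  labellingsInto0-sound : ∀ {Q g} → g ∈ labellingsInto0 Q → OrderPreserving Q 0 g
  labellingsInto0-sound {[]} _ = (λ ()) , (λ ())

  labellingsInto0-complete : ∀ {Q g} → OrderPreserving Q 0 g → Any (_≈[ Q ] g) (labellingsInto0 Q)
  labellingsInto0-complete {[]}    _ = here λ ()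
  labellingsInto0-complete {_ ∷ _} (bounded , _) =
    let 1≤gc , gc≤0 = bounded (here refl) in ⊥-elim (1+n≰n (≤-trans 1≤gc gc≤0))

  labellingsInto0-distinct : ∀ {Q} → Distinct Q (labellingsInto0 Q)
  labellingsInto0-distinct {[]}    = All.[] ∷ []
  labellingsInto0-distinct {_ ∷ _} = []

  orderPreserving-weaken : ∀ {Q m g} → OrderPreserving Q m g → OrderPreserving Q (suc m) g
  orderPreserving-weaken (bounded , monotone) =
    (λ c∈Q → proj₁ (bounded c∈Q) , m≤n⇒m≤1+n (proj₂ (bounded c∈Q))) , monotone

  orderPreserving-restrict : ∀ {Q A m g} → (∀ {c} → c ∈ A → c ∈ Q) → OrderPreserving Q (suc m) g →
    (∀ {c} → c ∈ A → g c ≢ suc m) → OrderPreserving A m g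
  orderPreserving-restrict A⊆Q (bounded , monotone) below =
    (λ c∈A → let 1≤gc , gc≤1+m = bounded (A⊆Q c∈A) in 1≤gc , ≤-pred (≤∧≢⇒< gc≤1+m (below c∈A))) ,
    (λ c∈A c′∈A → monotone (A⊆Q c∈A) (A⊆Q c′∈A))

  orderPreservingMaps-sound : ∀ m {Q g} → g ∈ orderPreservingMaps Q m → OrderPreserving Q m g
  orderPreservingMaps-sound zero    g∈ = labellingsInto0-sound g∈
  orderPreservingMaps-sound (suc m) {Q} g∈ with ∈-++⁻ (orderPreservingMaps Q m) g∈
  ... | inj₁ g∈below = orderPreserving-weaken (orderPreservingMaps-sound m g∈below)
  ... | inj₂ g∈top   = extendTop-sound (orderPreservingMaps-sound m) g∈top

  orderPreservingMaps-complete : ∀ m {Q g} → OrderPreserving Q m g →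
    Any (_≈[ Q ] g) (orderPreservingMaps Q m)
  orderPreservingMaps-complete zero    op = labellingsInto0-complete op
  orderPreservingMaps-complete (suc m) {Q} {g} op with any? (λ c → g c ℕ.≟ suc m) Q
  ... | yes attains = Any.++⁺ʳ (orderPreservingMaps Q m) (extendTop-complete op attains
        λ sp below _ → orderPreservingMaps-complete m (orderPreserving-restrict (interleaving-∈ˡ sp) op below))
  ... | no ¬attains = Any.++⁺ˡ (orderPreservingMaps-complete m
        (orderPreserving-restrict id op (λ c∈Q gc≡ → ¬attains (lose c∈Q gc≡))))

  orderPreservingMaps-distinct : ∀ m {Q} → Unique Q → Distinct Q (orderPreservingMaps Q m)
  orderPreservingMaps-distinct zero    _  = labellingsInto0-distinct
  orderPreservingMaps-distinct (suc m) Q! =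
    AllPairs.++⁺ (orderPreservingMaps-distinct m Q!)
      (extendTop-distinct Q! (orderPreservingMaps-distinct m) (proj₁ ∘ orderPreservingMaps-sound m))
      (All.tabulate λ g∈ → All.tabulate λ h∈ g≈h →
        let c , c∈Q , hc≡ = find (extendTop-attains h∈) in
        1+n≰n (subst (_≤ m) (trans (g≈h c∈Q) hc≡) (proj₂ (proj₁ (orderPreservingMaps-sound m g∈) c∈Q))))

  surjections-sound : ∀ s {Q g} → g ∈ surjections Q s → OrderPreserving Q s g
  surjections-sound zero    g∈ = labellingsInto0-sound g∈
  surjections-sound (suc s) g∈ = extendTop-sound (surjections-sound s) g∈

  surjections-complete : ∀ s {Q g} → OrderPreserving Q s g → Surjective Q s g →
    Any (_≈[ Q ] g) (surjections Q s)
  surjections-complete zero    op _    = labellingsInto0-complete op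
  surjections-complete (suc s) {Q} {g} op onto =
    extendTop-complete op (onto (suc s) (s≤s z≤n) ≤-refl) λ {A} sp below top →
      surjections-complete s (orderPreserving-restrict (interleaving-∈ˡ sp) op below) (onto-below sp top)
    where
      onto-below : ∀ {A B} → Interleaving A B Q → (∀ {c} → c ∈ B → g c ≡ suc s) → Surjective A s g
      onto-below sp top v 1≤v v≤s with find (onto v 1≤v (m≤n⇒m≤1+n v≤s))
      ... | c , c∈Q , gc≡v with interleaving-∈⁻ sp c∈Q
      ...   | inj₁ c∈A = lose c∈A gc≡v
      ...   | inj₂ c∈B = ⊥-elim (1+n≰n (subst (_≤ s) (trans (sym gc≡v) (top c∈B)) v≤s))

  surjections-distinct : ∀ s {Q} → Unique Q → Distinct Q (surjections Q s)
  surjections-distinct zero    _  = labellingsInto0-distinct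
  surjections-distinct (suc s) Q! =
    extendTop-distinct Q! (surjections-distinct s) (proj₁ ∘ surjections-sound s)

  Ω : List E → ℕ → ℕ
  Ω Q m = length (orderPreservingMaps Q m)

  surjCount : List E → ℕ → ℕ
  surjCount Q s = length (surjections Q s)

  Ω-suc : ∀ Q m → Ω Q (suc m) ≡ Ω Q m + sum (map (λ (A , _) → Ω A m) (topSplits Q))
  Ω-suc Q m = trans (length-++ (orderPreservingMaps Q m))
    (cong (Ω Q m +_) (length-extendTop (suc m) (λ A → orderPreservingMaps A m) Q))

  surjCount-suc : ∀ Q s → surjCount Q (suc s) ≡ sum (map (λ (A , _) → surjCount A s) (topSplits Q))
  surjCount-suc Q s = length-extendTop (suc s) (λ A → surjections A s) Q

  surjCount-vanishes : ∀ s Q → length Q < s → surjCount Q s ≡ 0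
  surjCount-vanishes (suc s) Q |Q|<1+s = trans (surjCount-suc Q s) (sum-map-zero (All.tabulate
    λ AB∈ → surjCount-vanishes s _ (<-≤-trans (topSplit-shorter {Q} AB∈) (≤-pred |Q|<1+s))))

  Ω≡∑surjCount*C : ∀ K m Q → length Q < K → Ω Q m ≡ ∑[ s < K ] (surjCount Q s * (m C s))
  Ω≡∑surjCount*C (suc K) zero Q _ = sym (begin
    surjCount Q 0 * 1 + ∑[ s < K ] (surjCount Q (suc s) * 0)
      ≡⟨ cong₂ _+_ (*-identityʳ _) (trans (sumUpTo-cong K (λ s → *-zeroʳ (surjCount Q (suc s)))) (sumUpTo-zero K)) ⟩
    surjCount Q 0 + 0
      ≡⟨ +-identityʳ _ ⟩
    Ω Q 0
      ∎)
    where open ≡-Reasoning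
  Ω≡∑surjCount*C (suc K) (suc m) Q |Q|<1+K = begin
    Ω Q (suc m)
      ≡⟨ Ω-suc Q m ⟩
    Ω Q m + sum (map (λ (A , _) → Ω A m) (topSplits Q))
      ≡⟨ cong₂ _+_ (Ω≡∑surjCount*C (suc K) m Q |Q|<1+K) (cong sum (map-cong-local (All.tabulate λ AB∈ →
           Ω≡∑surjCount*C (suc K) m _ (<-trans (topSplit-shorter {Q} AB∈) |Q|<1+K)))) ⟩
    ∑[ s < suc K ] (a s * (m C s)) + sum (map (λ (A , _) → ∑[ s < suc K ] (surjCount A s * (m C s))) (topSplits Q))
      ≡⟨ cong (∑[ s < suc K ] (a s * (m C s)) +_)
           (sum-map-sumUpTo (suc K) (λ (A , _) s → surjCount A s * (m C s)) (topSplits Q)) ⟩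
    ∑[ s < suc K ] (a s * (m C s)) + ∑[ s < suc K ] (sum (map (λ (A , _) → surjCount A s * (m C s)) (topSplits Q)))
      ≡⟨ cong (∑[ s < suc K ] (a s * (m C s)) +_) (sumUpTo-cong (suc K) λ s →
           trans (sum-map-*ʳ (λ (A , _) → surjCount A s) (m C s) (topSplits Q))
                 (cong (_* (m C s)) (sym (surjCount-suc Q s)))) ⟩
    ∑[ s < suc K ] (a s * (m C s)) + ∑[ s < suc K ] (a (suc s) * (m C s))
      ≡⟨ sumUpTo-pascal K a m (surjCount-vanishes (suc K) Q |Q|<1+K) ⟩
    ∑[ s < suc K ] (a s * (suc m C s))
      ∎
    where
      open ≡-Reasoning
      a = surjCount Q

  InjectiveOn : List E → Labelling → Set
  InjectiveOn Q g = ∀ {c c′} → c ∈ Q → c′ ∈ Q → g c ≡ g c′ → c ≡ c′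

  LinearExtension : List E → Labelling → Set
  LinearExtension Q g = OrderPreserving Q (length Q) g × InjectiveOn Q g

  length-≤-injective : ∀ {B : Set} (_≟ᴮ_ : DecidableEquality B) {Q : List E} {R : List B}
    (f : E → B) → Unique Q → (∀ {c c′} → c ∈ Q → c′ ∈ Q → f c ≡ f c′ → c ≡ c′) →
    (∀ {c} → c ∈ Q → f c ∈ R) → length Q ≤ length R
  length-≤-injective _≟ᴮ_ {[]}    f _ _ _ = z≤n
  length-≤-injective _≟ᴮ_ {x ∷ Q} {R} f (x∉Q ∷ Q!) injective f∈R = begin-strict
    length Q                     ≤⟨ length-≤-injective _≟ᴮ_ f Q! (λ c∈ c′∈ → injective (there c∈) (there c′∈)) f∈R′ ⟩
    length (filter ≢fx? R)        <⟨ filter-notAll ≢fx? R (Any.map (λ fx≡y y≢fx → y≢fx (sym fx≡y)) (f∈R (here refl))) ⟩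
    length R                     ∎
    where
      open ≤-Reasoning
      ≢fx? = λ y → ¬? (y ≟ᴮ f x)
      f∈R′ : ∀ {c} → c ∈ Q → f c ∈ filter ≢fx? R
      f∈R′ c∈Q = ∈-filter⁺ ≢fx? (f∈R (there c∈Q)) λ fc≡fx →
        All.lookup x∉Q c∈Q (injective (here refl) (there c∈Q) (sym fc≡fx))

  injective⇒surjective : ∀ {Q g} → Unique Q → Bounded Q (length Q) g → InjectiveOn Q g →
    Surjective Q (length Q) g
  injective⇒surjective {Q} {g} Q! bounded injective v 1≤v v≤N with any? (λ c → g c ℕ.≟ v) Q
  ... | yes attains = attains
  ... | no ¬attains = ⊥-elim (<-irrefl refl (begin-strict
    length Q                      ≤⟨ length-≤-injective ℕ._≟_ g Q! injective g∈R ⟩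
    length (filter ≢v? oneToN)     <⟨ filter-notAll ≢v? oneToN (lose (∈oneToN 1≤v v≤N) λ v≢v → v≢v refl) ⟩
    length oneToN                 ≡⟨ length-applyUpTo suc (length Q) ⟩
    length Q                      ∎))
    where
      open ≤-Reasoning
      oneToN = applyUpTo suc (length Q)
      ≢v? = λ x → ¬? (x ℕ.≟ v)
      ∈oneToN : ∀ {x} → 1 ≤ x → x ≤ length Q → x ∈ oneToN
      ∈oneToN (s≤s z≤n) x≤N = ∈-applyUpTo⁺ suc x≤N
      g∈R : ∀ {c} → c ∈ Q → g c ∈ filter ≢v? oneToN
      g∈R c∈Q = let 1≤gc , gc≤N = bounded c∈Q in
        ∈-filter⁺ ≢v? (∈oneToN 1≤gc gc≤N) (λ gc≡v → ¬attains (lose c∈Q gc≡v))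

  length≡1-∈ : ∀ {xs : List E} {c c′} → length xs ≡ 1 → c ∈ xs → c′ ∈ xs → c ≡ c′
  length≡1-∈ {_ ∷ []} _ (here refl) (here refl) = refl

  surjections-injective : ∀ s {Q g} → Unique Q → length Q ≡ s → g ∈ surjections Q s → InjectiveOn Q g
  surjections-injective zero    {[]} _ _ _ = λ ()
  surjections-injective (suc s) {Q} Q! |Q|≡1+s g∈
    with ∈-extendTop⁻ {suc s} {λ A → surjections A s} {Q} g∈
  ... | A , B , h , AB∈ , h∈ , refl = injective
    where
      sp = proj₁ (∈-topSplits⁻ {Q} AB∈)
      |A|≡s : length A ≡ s
      |A|≡s = ≤-antisym (≤-pred (subst (length A <_) |Q|≡1+s (topSplit-shorter {Q} AB∈)))
        (≮⇒≥ λ |A|<s → <⇒≢ (∈-length h∈) (sym (surjCount-vanishes s A |A|<s)))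
      |B|≡1 : length B ≡ 1
      |B|≡1 = +-cancelˡ-≡ s _ _ (begin
        s + length B          ≡⟨ cong (_+ length B) |A|≡s ⟨
        length A + length B   ≡⟨ interleave-length {as = Q} sp ⟨
        length Q              ≡⟨ trans |Q|≡1+s (+-comm 1 s) ⟩
        s + 1                 ∎)
        where open ≡-Reasoning
      below : ∀ {c} → c ∈ A → (h [ B ≔ suc s ]) c ≡ h c
      below c∈A = [≔]-∉ (interleaving-disjoint Q! sp c∈A)
      ≢top : ∀ {c} → c ∈ A → (h [ B ≔ suc s ]) c ≢ suc s
      ≢top c∈A eq = 1+n≰n (subst (_≤ s) (trans (sym (below c∈A)) eq)
        (proj₂ (proj₁ (surjections-sound s h∈) c∈A)))
      injective : InjectiveOn Q (h [ B ≔ suc s ])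
      injective c∈Q c′∈Q eq with interleaving-∈⁻ sp c∈Q | interleaving-∈⁻ sp c′∈Q
      ... | inj₁ c∈A | inj₁ c′∈A = surjections-injective s (interleaving-uniqueˡ Q! sp) |A|≡s h∈ c∈A c′∈A
                                     (trans (sym (below c∈A)) (trans eq (below c′∈A)))
      ... | inj₁ c∈A | inj₂ c′∈B = ⊥-elim (≢top c∈A (trans eq ([≔]-∈ c′∈B)))
      ... | inj₂ c∈B | inj₁ c′∈A = ⊥-elim (≢top c′∈A (trans (sym eq) ([≔]-∈ c∈B)))
      ... | inj₂ c∈B | inj₂ c′∈B = length≡1-∈ |B|≡1 c∈B c′∈B

  card-orderPreserving : ∀ {Q} m → Unique Q →
    Card (λ g h → g ≈[ Q ] h) (OrderPreserving Q m) (Ω Q m)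
  card-orderPreserving {Q} m Q! =
    card-fromList ≈-sym (orderPreservingMaps Q m)
      (orderPreservingMaps-sound m) (orderPreservingMaps-distinct m Q!)
      (λ _ → orderPreservingMaps-complete m)

  card-linearExtensions : ∀ {Q} → Unique Q →
    Card (λ g h → g ≈[ Q ] h) (LinearExtension Q) (surjCount Q (length Q))
  card-linearExtensions {Q} Q! =
    card-fromList ≈-sym (surjections Q (length Q))
      (λ g∈ → surjections-sound (length Q) g∈ , λ {c c′} → surjections-injective (length Q) Q! refl g∈)
      (surjections-distinct (length Q) Q!)
      (λ g (le : LinearExtension Q g) → surjections-complete (length Q) (proj₁ le)
        (injective⇒surjective {Q} {g} Q! (proj₁ (proj₁ le)) (proj₂ le)))

  module _ (⊑-trans : Transitive _⊑_) (⊑-antisym : Antisymmetric _≡_ _⊑_) where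

    maximal : ∀ x Q → ∃ λ y → y ∈ x ∷ Q × (∀ {c} → c ∈ x ∷ Q → y ⊑ c → c ≡ y)
    maximal x []      = x , here refl , λ { (here c≡x) _ → c≡x }
    maximal x (x′ ∷ Q) with maximal x′ Q
    ... | y , y∈ , y-max with y ⊑? x
    ...   | yes y⊑x = x , here refl , λ where
                (here c≡x) _     → c≡x
                (there c∈) x⊑c → let c≡y = y-max c∈ (⊑-trans y⊑x x⊑c) in
                  ⊑-antisym (subst (_⊑ x) (sym c≡y) y⊑x) (x⊑c)
    ...   | no  y⋢x = y , there y∈ , λ where
                (here refl) y⊑c → ⊥-elim (y⋢x y⊑c)
                (there c∈)  y⊑c → y-max c∈ y⊑c

    surjCount-positive : ∀ s {Q} → Unique Q → length Q ≡ s → 1 ≤ surjCount Q s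
    surjCount-positive zero    {[]}     _  _      = s≤s z≤n
    surjCount-positive (suc s) {x ∷ Q′} Q! |Q|≡1+s with maximal x Q′
    ... | y , y∈Q , y-max =
      subst (1 ≤_) (sym (surjCount-suc Q s))
        (sum-map-≥ (lose (∈-topSplits⁺ {Q} sp (upSet , 0<|B|))
          (surjCount-positive s (interleaving-uniqueˡ Q! sp) |A|≡s)))
      where
        Q = x ∷ Q′
        ≡y? = λ c → c ≟ y
        A = filter (¬? ∘ ≡y?) Q
        B = filter ≡y? Q
        sp : Interleaving A B Q
        sp = interleaving-filter ≡y? Q
        ≡y : ∀ {c} → c ∈ B → c ≡ y
        ≡y c∈B = proj₂ (∈-filter⁻ ≡y? {xs = Q} c∈B)
        upSet : UpSet Q B
        upSet = All.tabulate λ c∈B → All.tabulate λ c′∈Q c⊑c′ →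
          ∈-filter⁺ ≡y? c′∈Q (y-max c′∈Q (subst (_⊑ _) (≡y c∈B) c⊑c′))
        0<|B| : 0 < length B
        0<|B| = ∈-length (∈-filter⁺ ≡y? y∈Q refl)
        |B|≤1 : length B ≤ 1
        |B|≤1 = length-≤-injective _≟_ {R = y ∷ []} id (interleaving-uniqueʳ Q! sp) (λ _ _ c≡c′ → c≡c′)
          (λ c∈B → here (≡y c∈B))
        |A|≡s : length A ≡ s
        |A|≡s = +-cancelʳ-≡ 1 (length A) s (begin
          length A + 1          ≡⟨ cong (length A +_) (≤-antisym |B|≤1 0<|B|) ⟨
          length A + length B   ≡⟨ interleave-length {as = Q} sp ⟨
          length Q              ≡⟨ trans |Q|≡1+s (+-comm 1 s) ⟩
          s + 1                 ∎)
          where open ≡-Reasoning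

module BinomialPolynomials where

  open import Defs using (ℕtoℚ; evalPoly)
  open import Data.Nat as ℕ using (ℕ; zero; suc; _!; _∸_; _≤_; s≤s)
  import Data.Nat.Properties as ℕ
  open import Data.Nat.Combinatorics using (_C_; nCk+nC[k+1]≡[n+1]C[k+1]; nC1≡n; k>n⇒nCk≡0)
  import Data.Integer.Properties as ℤ
  open import Data.Rational using (ℚ; mkℚ; _+_; _*_; _-_; 1/_; 0ℚ; 1ℚ; ↥_)
  open import Data.Rational.Properties
    using (↥p/↧p≡p; toℚᵘ-injective; toℚᵘ-homo-+; toℚᵘ-homo-*; *-inverseʳ; *-zeroʳ)
  import Data.Rational.Unnormalised as ℚᵘ
  import Data.Rational.Unnormalised.Properties as ℚᵘ
  open import Data.Rational.Solver using (module +-*-Solver)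
  open import Data.Nat.Coprimality using (1-coprimeTo)
  import Data.Nat.Coprimality as Coprime
  open import Data.Vec using (Vec; []; _∷_; zipWith; map; last; _∷ʳ_)
  open import Data.Vec.Properties using (last-∷ʳ)
  open import Data.Product using (Σ; _×_; _,_)
  open import Data.Sum using ([_,_]′)
  open import Relation.Binary.PropositionalEquality
  open NatSums using (sumUpTo; sumUpTo-suc)
  open +-*-Solver using (solve; _:+_; _:*_; _:-_; _:=_; con)
  import Data.Integer as ℤ using (+_; _+_; _*_)

  -- ℕtoℚ k normalises (+ k) / 1 through a gcd that does not compute for a variable k;
  -- ι k is the same rational with its normal form given directly.
  ι : ℕ → ℚ
  ι k = mkℚ (ℤ.+ k) 0 (Coprime.sym (1-coprimeTo k))

  ℕtoℚ≡ι : ∀ k → ℕtoℚ k ≡ ι k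
  ℕtoℚ≡ι k = ↥p/↧p≡p (ι k)

  ℕtoℚ-+ : ∀ a b → ℕtoℚ (a ℕ.+ b) ≡ ℕtoℚ a + ℕtoℚ b
  ℕtoℚ-+ a b = trans (ℕtoℚ≡ι (a ℕ.+ b)) (trans ι-+ (sym (cong₂ _+_ (ℕtoℚ≡ι a) (ℕtoℚ≡ι b))))
    where
      ι-+ : ι (a ℕ.+ b) ≡ ι a + ι b
      ι-+ = toℚᵘ-injective (ℚᵘ.≃-trans (ℚᵘ.*≡* (cong (ℤ._* ℤ.+ 1) (trans (ℤ.pos-+ a b)
        (sym (cong₂ ℤ._+_ (ℤ.*-identityʳ (ℤ.+ a)) (ℤ.*-identityʳ (ℤ.+ b)))))))
        (ℚᵘ.≃-sym (toℚᵘ-homo-+ (ι a) (ι b))))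

  ℕtoℚ-* : ∀ a b → ℕtoℚ (a ℕ.* b) ≡ ℕtoℚ a * ℕtoℚ b
  ℕtoℚ-* a b = trans (ℕtoℚ≡ι (a ℕ.* b)) (trans ι-* (sym (cong₂ _*_ (ℕtoℚ≡ι a) (ℕtoℚ≡ι b))))
    where
      ι-* : ι (a ℕ.* b) ≡ ι a * ι b
      ι-* = toℚᵘ-injective (ℚᵘ.≃-trans (ℚᵘ.*≡* (cong (ℤ._* ℤ.+ 1) (ℤ.pos-* a b)))
        (ℚᵘ.≃-sym (toℚᵘ-homo-* (ι a) (ι b))))

  ℕtoℚ-≡0 : ∀ k → ℕtoℚ k ≡ 0ℚ → k ≡ 0
  ℕtoℚ-≡0 k k≡0 = ℤ.+-injective (cong ↥_ (trans (sym (ℕtoℚ≡ι k)) k≡0))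

  ℕtoℚ-∸ : ∀ {m s} → s ≤ m → ℕtoℚ (m ∸ s) ≡ ℕtoℚ m - ℕtoℚ s
  ℕtoℚ-∸ {m} {s} s≤m = begin
    ℕtoℚ (m ∸ s)                      ≡⟨ solve 2 (λ d s → d := (d :+ s) :- s) refl (ℕtoℚ (m ∸ s)) (ℕtoℚ s) ⟩
    (ℕtoℚ (m ∸ s) + ℕtoℚ s) - ℕtoℚ s   ≡⟨ cong (_- ℕtoℚ s) (trans (sym (ℕtoℚ-+ (m ∸ s) s)) (cong ℕtoℚ (ℕ.m∸n+n≡m s≤m))) ⟩
    ℕtoℚ m - ℕtoℚ s                   ∎
    where open ≡-Reasoning

  1/suc : ℕ → ℚ
  1/suc s = 1/ ι (suc s)

  ℕtoℚ-*-1/suc : ∀ s → ℕtoℚ (suc s) * 1/suc s ≡ 1ℚ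
  ℕtoℚ-*-1/suc s = trans (cong (_* 1/suc s) (ℕtoℚ≡ι (suc s))) (*-inverseʳ (ι (suc s)))

  _⊕_ : ∀ {n} → Vec ℚ n → Vec ℚ n → Vec ℚ n
  _⊕_ = zipWith _+_

  _⊛_ : ∀ {n} → ℚ → Vec ℚ n → Vec ℚ n
  k ⊛ p = map (k *_) p

  pad : ∀ {n} → Vec ℚ n → Vec ℚ (suc n)
  pad p = p ∷ʳ 0ℚ

  X+_⊛_ : ∀ {n} → ℚ → Vec ℚ n → Vec ℚ (suc n)
  X+ r ⊛ p = (0ℚ ∷ p) ⊕ pad (r ⊛ p)

  evalPoly-⊕ : ∀ {n} (p q : Vec ℚ n) x → evalPoly (p ⊕ q) x ≡ evalPoly p x + evalPoly q x
  evalPoly-⊕ []      []      x = refl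
  evalPoly-⊕ (a ∷ p) (b ∷ q) x = trans (cong (λ e → a + b + x * e) (evalPoly-⊕ p q x))
    (solve 5 (λ a b x e f → a :+ b :+ x :* (e :+ f) := (a :+ x :* e) :+ (b :+ x :* f)) refl
      a b x (evalPoly p x) (evalPoly q x))

  evalPoly-⊛ : ∀ {n} k (p : Vec ℚ n) x → evalPoly (k ⊛ p) x ≡ k * evalPoly p x
  evalPoly-⊛ k []      x = sym (*-zeroʳ k)
  evalPoly-⊛ k (a ∷ p) x = trans (cong (λ e → k * a + x * e) (evalPoly-⊛ k p x))
    (solve 4 (λ k a x e → k :* a :+ x :* (k :* e) := k :* (a :+ x :* e)) refl k a x (evalPoly p x))

  evalPoly-pad : ∀ {n} (p : Vec ℚ n) x → evalPoly (pad p) x ≡ evalPoly p x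
  evalPoly-pad []      x = solve 1 (λ x → con 0ℚ :+ x :* con 0ℚ := con 0ℚ) refl x
  evalPoly-pad (a ∷ p) x = cong (λ e → a + x * e) (evalPoly-pad p x)

  evalPoly-X+⊛ : ∀ {n} r (p : Vec ℚ n) x → evalPoly (X+ r ⊛ p) x ≡ (x + r) * evalPoly p x
  evalPoly-X+⊛ r p x = begin
    evalPoly ((0ℚ ∷ p) ⊕ pad (r ⊛ p)) x          ≡⟨ evalPoly-⊕ (0ℚ ∷ p) (pad (r ⊛ p)) x ⟩
    (0ℚ + x * evalPoly p x) + evalPoly (pad (r ⊛ p)) x
      ≡⟨ cong ((0ℚ + x * evalPoly p x) +_) (trans (evalPoly-pad (r ⊛ p) x) (evalPoly-⊛ r p x)) ⟩
    (0ℚ + x * evalPoly p x) + r * evalPoly p x   ≡⟨ solve 3 (λ x r e → (con 0ℚ :+ x :* e) :+ r :* e := (x :+ r) :* e) refl x r (evalPoly p x) ⟩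
    (x + r) * evalPoly p x                       ∎
    where open ≡-Reasoning

  last-⊕ : ∀ {n} (p q : Vec ℚ (suc n)) → last (p ⊕ q) ≡ last p + last q
  last-⊕ (a ∷ [])     (b ∷ [])     = refl
  last-⊕ (a ∷ a′ ∷ p) (b ∷ b′ ∷ q) = last-⊕ (a′ ∷ p) (b′ ∷ q)

  last-⊛ : ∀ {n} k (p : Vec ℚ (suc n)) → last (k ⊛ p) ≡ k * last p
  last-⊛ k (a ∷ [])     = refl
  last-⊛ k (a ∷ a′ ∷ p) = last-⊛ k (a′ ∷ p)

  last-X+⊛ : ∀ {n} r (p : Vec ℚ (suc n)) → last (X+ r ⊛ p) ≡ last p
  last-X+⊛ r p = begin
    last ((0ℚ ∷ p) ⊕ pad (r ⊛ p))   ≡⟨ last-⊕ (0ℚ ∷ p) (pad (r ⊛ p)) ⟩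
    last p + last (pad (r ⊛ p))     ≡⟨ cong (last p +_) (last-∷ʳ 0ℚ (r ⊛ p)) ⟩
    last p + 0ℚ                     ≡⟨ solve 1 (λ l → l :+ con 0ℚ := l) refl (last p) ⟩
    last p                          ∎
    where open ≡-Reasoning

  C-suc-* : ∀ m s → (m C suc s) ℕ.* suc s ≡ (m C s) ℕ.* (m ∸ s)
  C-suc-* zero    s       = sym (trans (cong ((0 C s) ℕ.*_) (ℕ.0∸n≡0 s)) (ℕ.*-zeroʳ (0 C s)))
  C-suc-* (suc m) zero    = trans (ℕ.*-identityʳ (suc m C 1)) (trans (nC1≡n (suc m)) (sym (ℕ.+-identityʳ (suc m))))
  C-suc-* (suc m) (suc s) = begin
    (suc m C suc (suc s)) ℕ.* suc (suc s)
      ≡⟨ cong (ℕ._* suc (suc s)) (nCk+nC[k+1]≡[n+1]C[k+1] m (suc s)) ⟨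
    (m C suc s ℕ.+ m C suc (suc s)) ℕ.* suc (suc s)
      ≡⟨ ℕ.*-distribʳ-+ (suc (suc s)) (m C suc s) _ ⟩
    (m C suc s) ℕ.* suc (suc s) ℕ.+ (m C suc (suc s)) ℕ.* suc (suc s)
      ≡⟨ cong ((m C suc s) ℕ.* suc (suc s) ℕ.+_) (C-suc-* m (suc s)) ⟩
    (m C suc s) ℕ.* suc (suc s) ℕ.+ (m C suc s) ℕ.* (m ∸ suc s)
      ≡⟨ ℕ.*-distribˡ-+ (m C suc s) (suc (suc s)) (m ∸ suc s) ⟨
    (m C suc s) ℕ.* (suc (suc s) ℕ.+ (m ∸ suc s))
      ≡⟨ shift ⟩
    (m C suc s) ℕ.* (suc s ℕ.+ (m ∸ s))
      ≡⟨ ℕ.*-distribˡ-+ (m C suc s) (suc s) (m ∸ s) ⟩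
    (m C suc s) ℕ.* suc s ℕ.+ (m C suc s) ℕ.* (m ∸ s)
      ≡⟨ cong (ℕ._+ (m C suc s) ℕ.* (m ∸ s)) (C-suc-* m s) ⟩
    (m C s) ℕ.* (m ∸ s) ℕ.+ (m C suc s) ℕ.* (m ∸ s)
      ≡⟨ ℕ.*-distribʳ-+ (m ∸ s) (m C s) (m C suc s) ⟨
    (m C s ℕ.+ m C suc s) ℕ.* (m ∸ s)
      ≡⟨ cong (ℕ._* (m ∸ s)) (nCk+nC[k+1]≡[n+1]C[k+1] m s) ⟩
    (suc m C suc s) ℕ.* (m ∸ s)
      ∎
    where
      open ≡-Reasoning
      shift : (m C suc s) ℕ.* (suc (suc s) ℕ.+ (m ∸ suc s)) ≡ (m C suc s) ℕ.* (suc s ℕ.+ (m ∸ s))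
      shift = [ (λ s<m → cong (λ k → (m C suc s) ℕ.* suc k)
                           (trans (ℕ.m+[n∸m]≡n s<m) (sym (ℕ.m+[n∸m]≡n (ℕ.<⇒≤ s<m)))))
              , (λ m≤s → trans (cong (ℕ._* (suc (suc s) ℕ.+ (m ∸ suc s))) (k>n⇒nCk≡0 (s≤s m≤s)))
                           (sym (cong (ℕ._* (suc s ℕ.+ (m ∸ s))) (k>n⇒nCk≡0 (s≤s m≤s)))))
              ]′ (ℕ.<-≤-connex s m)

  ℕtoℚ-C-*-∸ : ∀ t s → (ℕtoℚ t + (1ℚ - ℕtoℚ s)) * ℕtoℚ (suc t C s) ≡ ℕtoℚ ((suc t C s) ℕ.* (suc t ∸ s))
  ℕtoℚ-C-*-∸ t s = [ below , above ]′ (ℕ.≤-<-connex s m)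
    where
      open ≡-Reasoning
      x = ℕtoℚ t
      m = suc t
      r = 1ℚ - ℕtoℚ s
      below : s ℕ.≤ m → (x + r) * ℕtoℚ (m C s) ≡ ℕtoℚ ((m C s) ℕ.* (m ∸ s))
      below s≤m = begin
        (x + r) * ℕtoℚ (m C s)                 ≡⟨ solve 3 (λ x s c → (x :+ (con 1ℚ :- s)) :* c := c :* ((con 1ℚ :+ x) :- s)) refl x (ℕtoℚ s) (ℕtoℚ (m C s)) ⟩
        ℕtoℚ (m C s) * ((1ℚ + x) - ℕtoℚ s)     ≡⟨ cong (λ y → ℕtoℚ (m C s) * (y - ℕtoℚ s)) (ℕtoℚ-+ 1 t) ⟨
        ℕtoℚ (m C s) * (ℕtoℚ m - ℕtoℚ s)       ≡⟨ cong (ℕtoℚ (m C s) *_) (ℕtoℚ-∸ s≤m) ⟨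
        ℕtoℚ (m C s) * ℕtoℚ (m ∸ s)            ≡⟨ ℕtoℚ-* (m C s) (m ∸ s) ⟨
        ℕtoℚ ((m C s) ℕ.* (m ∸ s))             ∎
      above : m ℕ.< s → (x + r) * ℕtoℚ (m C s) ≡ ℕtoℚ ((m C s) ℕ.* (m ∸ s))
      above m<s = begin
        (x + r) * ℕtoℚ (m C s)                 ≡⟨ cong (λ k → (x + r) * ℕtoℚ k) (k>n⇒nCk≡0 m<s) ⟩
        (x + r) * 0ℚ                           ≡⟨ *-zeroʳ (x + r) ⟩
        0ℚ                                     ≡⟨ cong (λ k → ℕtoℚ (k ℕ.* (m ∸ s))) (k>n⇒nCk≡0 m<s) ⟨
        ℕtoℚ ((m C s) ℕ.* (m ∸ s))             ∎

  binomialPoly : (s : ℕ) → Vec ℚ (suc s)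
  binomialPoly zero    = 1ℚ ∷ []
  binomialPoly (suc s) = 1/suc s ⊛ (X+ (1ℚ - ℕtoℚ s) ⊛ binomialPoly s)

  evalPoly-binomialPoly : ∀ t s → evalPoly (binomialPoly s) (ℕtoℚ t) ≡ ℕtoℚ (suc t C s)
  evalPoly-binomialPoly t zero    = solve 1 (λ x → con 1ℚ :+ x :* con 0ℚ := con 1ℚ) refl (ℕtoℚ t)
  evalPoly-binomialPoly t (suc s) = begin
    evalPoly (1/suc s ⊛ (X+ r ⊛ binomialPoly s)) x
      ≡⟨ evalPoly-⊛ (1/suc s) (X+ r ⊛ binomialPoly s) x ⟩
    1/suc s * evalPoly (X+ r ⊛ binomialPoly s) x
      ≡⟨ cong (1/suc s *_) (trans (evalPoly-X+⊛ r (binomialPoly s) x)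
           (cong ((x + r) *_) (evalPoly-binomialPoly t s))) ⟩
    1/suc s * ((x + r) * ℕtoℚ (m C s))
      ≡⟨ cong (1/suc s *_) (ℕtoℚ-C-*-∸ t s) ⟩
    1/suc s * ℕtoℚ ((m C s) ℕ.* (m ∸ s))
      ≡⟨ cong (λ k → 1/suc s * ℕtoℚ k) (C-suc-* m s) ⟨
    1/suc s * ℕtoℚ ((m C suc s) ℕ.* suc s)
      ≡⟨ cong (1/suc s *_) (ℕtoℚ-* (m C suc s) (suc s)) ⟩
    1/suc s * (ℕtoℚ (m C suc s) * ℕtoℚ (suc s))
      ≡⟨ solve 3 (λ i c k → i :* (c :* k) := c :* (k :* i)) refl (1/suc s) (ℕtoℚ (m C suc s)) (ℕtoℚ (suc s)) ⟩
    ℕtoℚ (m C suc s) * (ℕtoℚ (suc s) * 1/suc s)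
      ≡⟨ cong (ℕtoℚ (m C suc s) *_) (ℕtoℚ-*-1/suc s) ⟩
    ℕtoℚ (m C suc s) * 1ℚ
      ≡⟨ solve 1 (λ c → c :* con 1ℚ := c) refl (ℕtoℚ (m C suc s)) ⟩
    ℕtoℚ (m C suc s)
      ∎
    where
      open ≡-Reasoning
      x = ℕtoℚ t
      m = suc t
      r = 1ℚ - ℕtoℚ s

  last-binomialPoly : ∀ s → ℕtoℚ (s !) * last (binomialPoly s) ≡ 1ℚ
  last-binomialPoly zero    = refl
  last-binomialPoly (suc s) = begin
    ℕtoℚ (suc s ℕ.* s !) * last (1/suc s ⊛ (X+ r ⊛ binomialPoly s))
      ≡⟨ cong₂ _*_ (ℕtoℚ-* (suc s) (s !))
           (trans (last-⊛ (1/suc s) (X+ r ⊛ binomialPoly s)) (cong (1/suc s *_) (last-X+⊛ r (binomialPoly s)))) ⟩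
    (ℕtoℚ (suc s) * ℕtoℚ (s !)) * (1/suc s * last (binomialPoly s))
      ≡⟨ solve 4 (λ k f i l → (k :* f) :* (i :* l) := (k :* i) :* (f :* l)) refl
           (ℕtoℚ (suc s)) (ℕtoℚ (s !)) (1/suc s) (last (binomialPoly s)) ⟩
    (ℕtoℚ (suc s) * 1/suc s) * (ℕtoℚ (s !) * last (binomialPoly s))
      ≡⟨ cong₂ _*_ (ℕtoℚ-*-1/suc s) (last-binomialPoly s) ⟩
    1ℚ * 1ℚ
      ∎
    where
      open ≡-Reasoning
      r = 1ℚ - ℕtoℚ s

  binomialSumPoly : (a : ℕ → ℕ) (N : ℕ) → Vec ℚ (suc N)
  binomialSumPoly a zero    = ℕtoℚ (a 0) ⊛ binomialPoly 0
  binomialSumPoly a (suc N) = pad (binomialSumPoly a N) ⊕ (ℕtoℚ (a (suc N)) ⊛ binomialPoly (suc N))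

  evalPoly-binomialSumPoly : ∀ a N t →
    evalPoly (binomialSumPoly a N) (ℕtoℚ t) ≡ ℕtoℚ (∑[ s < suc N ] (a s ℕ.* (suc t C s)))
  evalPoly-binomialSumPoly a zero    t = begin
    evalPoly (ℕtoℚ (a 0) ⊛ binomialPoly 0) (ℕtoℚ t)   ≡⟨ evalPoly-⊛ (ℕtoℚ (a 0)) (binomialPoly 0) (ℕtoℚ t) ⟩
    ℕtoℚ (a 0) * evalPoly (binomialPoly 0) (ℕtoℚ t)   ≡⟨ cong (ℕtoℚ (a 0) *_) (evalPoly-binomialPoly t 0) ⟩
    ℕtoℚ (a 0) * ℕtoℚ 1                              ≡⟨ ℕtoℚ-* (a 0) 1 ⟨
    ℕtoℚ (a 0 ℕ.* 1)                                 ≡⟨ cong ℕtoℚ (ℕ.+-identityʳ (a 0 ℕ.* 1)) ⟨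
    ℕtoℚ (a 0 ℕ.* 1 ℕ.+ 0)                           ∎
    where open ≡-Reasoning
  evalPoly-binomialSumPoly a (suc N) t = begin
    evalPoly (pad (binomialSumPoly a N) ⊕ (ℕtoℚ (a (suc N)) ⊛ binomialPoly (suc N))) x
      ≡⟨ evalPoly-⊕ (pad (binomialSumPoly a N)) _ x ⟩
    evalPoly (pad (binomialSumPoly a N)) x + evalPoly (ℕtoℚ (a (suc N)) ⊛ binomialPoly (suc N)) x
      ≡⟨ cong₂ _+_ (trans (evalPoly-pad (binomialSumPoly a N) x) (evalPoly-binomialSumPoly a N t))
           (trans (evalPoly-⊛ (ℕtoℚ (a (suc N))) (binomialPoly (suc N)) x)
                  (cong (ℕtoℚ (a (suc N)) *_) (evalPoly-binomialPoly t (suc N)))) ⟩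
    ℕtoℚ (sumUpTo (suc N) f) + ℕtoℚ (a (suc N)) * ℕtoℚ (suc t C suc N)
      ≡⟨ cong (ℕtoℚ (sumUpTo (suc N) f) +_) (ℕtoℚ-* (a (suc N)) (suc t C suc N)) ⟨
    ℕtoℚ (sumUpTo (suc N) f) + ℕtoℚ (f (suc N))
      ≡⟨ ℕtoℚ-+ (sumUpTo (suc N) f) (f (suc N)) ⟨
    ℕtoℚ (sumUpTo (suc N) f ℕ.+ f (suc N))
      ≡⟨ cong ℕtoℚ (sumUpTo-suc (suc N) f) ⟨
    ℕtoℚ (sumUpTo (suc (suc N)) f)
      ∎
    where
      open ≡-Reasoning
      x = ℕtoℚ t
      f = λ s → a s ℕ.* (suc t C s)

  last-binomialSumPoly : ∀ a N → last (binomialSumPoly a N) ≡ ℕtoℚ (a N) * last (binomialPoly N)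
  last-binomialSumPoly a zero    = refl
  last-binomialSumPoly a (suc N) = begin
    last (pad (binomialSumPoly a N) ⊕ (ℕtoℚ (a (suc N)) ⊛ binomialPoly (suc N)))
      ≡⟨ last-⊕ (pad (binomialSumPoly a N)) _ ⟩
    last (pad (binomialSumPoly a N)) + last (ℕtoℚ (a (suc N)) ⊛ binomialPoly (suc N))
      ≡⟨ cong₂ _+_ (last-∷ʳ 0ℚ (binomialSumPoly a N)) (last-⊛ (ℕtoℚ (a (suc N))) (binomialPoly (suc N))) ⟩
    0ℚ + ℕtoℚ (a (suc N)) * last (binomialPoly (suc N))
      ≡⟨ solve 1 (λ y → con 0ℚ :+ y := y) refl _ ⟩
    ℕtoℚ (a (suc N)) * last (binomialPoly (suc N))
      ∎
    where open ≡-Reasoning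

  leading-binomialSumPoly : ∀ a N → ℕtoℚ (a N) ≡ ℕtoℚ (N !) * last (binomialSumPoly a N)
  leading-binomialSumPoly a N = begin
    ℕtoℚ (a N)                                          ≡⟨ solve 1 (λ y → y := y :* con 1ℚ) refl (ℕtoℚ (a N)) ⟩
    ℕtoℚ (a N) * 1ℚ                                      ≡⟨ cong (ℕtoℚ (a N) *_) (last-binomialPoly N) ⟨
    ℕtoℚ (a N) * (ℕtoℚ (N !) * last (binomialPoly N))    ≡⟨ solve 3 (λ y f l → y :* (f :* l) := f :* (y :* l)) refl
                                                             (ℕtoℚ (a N)) (ℕtoℚ (N !)) (last (binomialPoly N)) ⟩
    ℕtoℚ (N !) * (ℕtoℚ (a N) * last (binomialPoly N))    ≡⟨ cong (ℕtoℚ (N !) *_) (last-binomialSumPoly a N) ⟨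
    ℕtoℚ (N !) * last (binomialSumPoly a N)              ∎
    where open ≡-Reasoning

  binomialSum-polynomial : ∀ (a : ℕ → ℕ) N → 1 ≤ a N →
    Σ (Vec ℚ (suc N)) λ c → last c ≢ 0ℚ ×
      (∀ t → ℕtoℚ (∑[ s < suc N ] (a s ℕ.* (suc t C s))) ≡ evalPoly c (ℕtoℚ t)) ×
      ℕtoℚ (a N) ≡ ℕtoℚ (N !) * last c
  binomialSum-polynomial a N 1≤aN =
    binomialSumPoly a N , last≢0 , (λ t → sym (evalPoly-binomialSumPoly a N t)) , leading-binomialSumPoly a N
    where
      last≢0 : last (binomialSumPoly a N) ≢ 0ℚ
      last≢0 last≡0 = ℕ.<⇒≢ 1≤aN (sym (ℕtoℚ-≡0 (a N)
        (trans (leading-binomialSumPoly a N) (trans (cong (ℕtoℚ (N !) *_) last≡0) (*-zeroʳ (ℕtoℚ (N !)))))))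

module PrefixSums where

  open import Defs using (psum)
  open import Data.Nat as ℕ using (ℕ; zero; suc; _⊓_; z≤n; s≤s)
  import Data.Nat.Properties as ℕ
  open import Data.Fin using (Fin; toℕ; fromℕ<; zero; suc)
  open import Data.Integer using (ℤ; 0ℤ; _+_; _-_)
  import Data.Integer.Properties as ℤ
  open import Data.Integer.Solver using (module +-*-Solver)
  open import Function using (_∘_)
  open import Relation.Binary.PropositionalEquality
  open +-*-Solver

  psum-cong : ∀ {n} {f h : Fin n → ℤ} → (∀ i → f i ≡ h i) → ∀ m → psum f m ≡ psum h m
  psum-cong {zero}  f≗h m       = refl
  psum-cong {suc n} f≗h zero    = refl
  psum-cong {suc n} f≗h (suc m) = cong₂ _+_ (f≗h zero) (psum-cong (f≗h ∘ suc) m)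

  psum-0 : ∀ {n} (f : Fin n → ℤ) → psum f 0 ≡ 0ℤ
  psum-0 {zero}  f = refl
  psum-0 {suc n} f = refl

  psum-zero : ∀ {n} (f : Fin n → ℤ) m → (∀ i → toℕ i ℕ.< m → f i ≡ 0ℤ) → psum f m ≡ 0ℤ
  psum-zero {zero}  f m       f≡0 = refl
  psum-zero {suc n} f zero    f≡0 = refl
  psum-zero {suc n} f (suc m) f≡0 =
    cong₂ _+_ (f≡0 zero (s≤s z≤n)) (psum-zero (f ∘ suc) m (λ i i<m → f≡0 (suc i) (s≤s i<m)))

  psum-+ : ∀ {n} (f h : Fin n → ℤ) m → psum (λ i → f i + h i) m ≡ psum f m + psum h m
  psum-+ {zero}  f h m       = refl
  psum-+ {suc n} f h zero    = refl
  psum-+ {suc n} f h (suc m) = trans (cong (f zero + h zero +_) (psum-+ (f ∘ suc) (h ∘ suc) m))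
    (solve 4 (λ a b c d → (a :+ b) :+ (c :+ d) := (a :+ c) :+ (b :+ d)) refl
      (f zero) (h zero) (psum (f ∘ suc) m) (psum (h ∘ suc) m))

  psum-suc : ∀ {n} (f : Fin n → ℤ) m (m<n : m ℕ.< n) → psum f (suc m) ≡ psum f m + f (fromℕ< m<n)
  psum-suc {suc n} f zero    _         = trans (cong (f zero +_) (psum-0 (f ∘ suc))) (ℤ.+-comm (f zero) 0ℤ)
  psum-suc {suc n} f (suc m) (s≤s m<n) = trans (cong (f zero +_) (psum-suc (f ∘ suc) m m<n))
    (sym (ℤ.+-assoc (f zero) (psum (f ∘ suc) m) (f (suc (fromℕ< m<n)))))

  psum-telescope : ∀ {n} (F : ℕ → ℤ) m → psum {n} (λ i → F (suc (toℕ i)) - F (toℕ i)) m ≡ F (m ⊓ n) - F 0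
  psum-telescope {zero}  F m rewrite ℕ.⊓-zeroʳ m = sym (ℤ.+-inverseʳ (F 0))
  psum-telescope {suc n} F zero    = sym (ℤ.+-inverseʳ (F 0))
  psum-telescope {suc n} F (suc m) = trans (cong (F 1 - F 0 +_) (psum-telescope {n} (F ∘ suc) m))
    (solve 3 (λ a b c → (a :- b) :+ (c :- a) := c :- b) refl (F 1) (F 0) (F (suc (m ⊓ n))))

  psum-tail-zero : ∀ {n} (f : Fin n → ℤ) m → (∀ i → m ℕ.≤ toℕ i → f i ≡ 0ℤ) → psum f m ≡ psum f n
  psum-tail-zero {zero}  f m       _   = refl
  psum-tail-zero {suc n} f zero    f≡0 = sym (cong₂ _+_ (f≡0 zero z≤n)
    (trans (sym (psum-tail-zero (f ∘ suc) 0 (λ i _ → f≡0 (suc i) z≤n))) (psum-0 (f ∘ suc))))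
  psum-tail-zero {suc n} f (suc m) f≡0 =
    cong (f zero +_) (psum-tail-zero (f ∘ suc) m (λ i m≤i → f≡0 (suc i) (s≤s m≤i)))

module Partitions where

  open import Defs using (part; IsPartitionIn)
  open import Data.Nat using (ℕ; zero; suc; _∸_; _≤_; _<_; z≤n; s≤s; _<?_)
  open import Data.Nat.Properties
  open import Data.List using (List; []; _∷_; length)
  open import Data.List.Relation.Unary.Linked using (Linked; []; [-]; _∷_)
  open import Data.Product using (proj₁; proj₂)
  open import Relation.Binary.PropositionalEquality using (_≡_; refl; subst)
  open import Relation.Nullary using (yes; no)

  part-beyond : ∀ (λ′ : List ℕ) i → length λ′ ≤ i → part λ′ i ≡ 0
  part-beyond []       i       _         = refl
  part-beyond (_ ∷ λ′) (suc i) (s≤s |λ|≤i) = part-beyond λ′ i |λ|≤i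

  part-antitone : ∀ {λ′ : List ℕ} → Linked (λ a b → b ≤ a) λ′ → ∀ {i j} → i ≤ j → part λ′ j ≤ part λ′ i
  part-antitone _           {j = zero}  z≤n = ≤-refl
  part-antitone []          {j = suc j} _   = z≤n
  part-antitone [-]         {j = suc j} _   = z≤n
  part-antitone (b≤a ∷ dec) {zero}  {suc j} _ = ≤-trans (part-antitone dec {0} {j} z≤n) b≤a
  part-antitone (_   ∷ dec) {suc i} {suc j} (s≤s i≤j) = part-antitone dec i≤j

  module _ {n : ℕ} {λ′ : List ℕ} (λ⊆δ : IsPartitionIn n λ′) where

    diagonal<rowEnd : ∀ i → i < n → i < n ∸ part λ′ i
    diagonal<rowEnd i i<n with i <? length λ′
    ... | yes i<|λ| = subst (_≤ n ∸ part λ′ i) (m+n∸m≡n (part λ′ i) (suc i))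
                        (∸-monoˡ-≤ (part λ′ i) (proj₂ (proj₂ λ⊆δ) i i<|λ|))
    ... | no  i≮|λ| rewrite part-beyond λ′ i (≮⇒≥ i≮|λ|) = i<n

    rowEnd-monotone : ∀ {i j} → i ≤ j → n ∸ part λ′ i ≤ n ∸ part λ′ j
    rowEnd-monotone i≤j = ∸-monoʳ-≤ n (part-antitone (proj₁ (proj₂ λ⊆δ)) i≤j)

module LatticePoints (n : ℕ) (λ′ : List ℕ) (t : ℕ) (λ⊆δ : IsPartitionIn n λ′) where

  open import Defs
  open import Data.Nat as ℕ using (zero; suc; _∸_; _⊓_; z≤n; s≤s)
  import Data.Nat.Properties as ℕ
  open import Data.Fin using (Fin; toℕ; fromℕ<)
  import Data.Fin.Properties as Fin
  open import Data.Integer using (ℤ; +_; 0ℤ; _+_; _-_; _≤_; +≤+; ∣_∣)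
  import Data.Integer.Properties as ℤ
  open import Data.Integer.Solver using (module +-*-Solver)
  open import Data.Product using (_×_; _,_; proj₁; proj₂)
  open import Data.Sum using (inj₁; inj₂)
  open import Data.Empty using (⊥-elim)
  open import Relation.Binary.PropositionalEquality
  open import Relation.Nullary using (yes; no)
  open PrefixSums
  open Cardinality using (card-transfer)
  open Partitions
  open +-*-Solver

  end : ℕ → ℕ
  end i = n ∸ part λ′ i

  i<end : ∀ i → i ℕ.< n → i ℕ.< end i
  i<end = diagonal<rowEnd λ⊆δ

  end-monotone : ∀ {i j} → i ℕ.≤ j → end i ℕ.≤ end j
  end-monotone = rowEnd-monotone λ⊆δ

  end≤n : ∀ i → end i ℕ.≤ n
  end≤n i = ℕ.m∸n≤m n (part λ′ i)

  Within : ℤ → Set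
  Within x = 0ℤ ≤ x × x ≤ + t

  within-difference : ∀ {a b} → b ≤ a → 0ℤ ≤ b → a ≤ + t → Within (a - b)
  within-difference {a} {b} b≤a 0≤b a≤t = ℤ.i≤j⇒0≤j-i b≤a ,
    ℤ.0≤i-j⇒j≤i (subst (0ℤ ≤_) (solve 3 (λ t a b → (t :- a) :+ b := t :- (a :- b)) refl (+ t) a b)
      (ℤ.+-mono-≤ (ℤ.i≤j⇒0≤j-i a≤t) 0≤b))

  within-t+difference : ∀ {a b} → 0ℤ ≤ a → a ≤ b → b ≤ + t → Within (+ t + (a - b))
  within-t+difference {a} {b} 0≤a a≤b b≤t =
    ℤ.0≤i-j⇒j≤i (subst (0ℤ ≤_) (solve 3 (λ t a b → (t :- b) :+ a := (t :+ (a :- b)) :- con 0ℤ) refl (+ t) a b)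
      (ℤ.+-mono-≤ (ℤ.i≤j⇒0≤j-i b≤t) 0≤a)) ,
    ℤ.0≤i-j⇒j≤i (subst (0ℤ ≤_) (solve 3 (λ t a b → b :- a := t :- (t :+ (a :- b))) refl (+ t) a b)
      (ℤ.i≤j⇒0≤j-i a≤b))

  monotone-chain : ∀ (F : ℕ → ℤ) → (∀ c → c ℕ.< n → F c ≤ F (suc c)) →
    ∀ {c c′} → c ℕ.≤ c′ → c′ ℕ.≤ n → F c ≤ F c′
  monotone-chain F step {c} {zero}   z≤n  _     = ℤ.≤-refl
  monotone-chain F step {c} {suc c′} c≤c′ c′<n with ℕ.m≤n⇒m<n∨m≡n c≤c′
  ... | inj₂ refl      = ℤ.≤-refl
  ... | inj₁ (s≤s c≤) = ℤ.≤-trans (monotone-chain F step c≤ (ℕ.<⇒≤ c′<n)) (step c′ c′<n)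

  ddiff : (ℕ → ℕ → ℤ) → IntMatrix n
  ddiff K i j = (K (suc (toℕ i)) (suc (toℕ j)) - K (toℕ i) (suc (toℕ j)))
              - (K (suc (toℕ i)) (toℕ j) - K (toℕ i) (toℕ j))

  columnPart : (ℕ → ℕ → ℤ) → ℕ → ℕ → ℤ
  columnPart K j r = K r (suc j) - K r j

  rowPart : (ℕ → ℕ → ℤ) → ℕ → ℕ → ℤ
  rowPart K i c = K (suc i) c - K i c

  ddiff-column : ∀ K i j → ddiff K i j ≡ columnPart K (toℕ j) (suc (toℕ i)) - columnPart K (toℕ j) (toℕ i)
  ddiff-column K i j = solve 4 (λ a b c d → (a :- b) :- (c :- d) := (a :- c) :- (b :- d)) refl
    (K (suc (toℕ i)) (suc (toℕ j))) (K (toℕ i) (suc (toℕ j))) (K (suc (toℕ i)) (toℕ j)) (K (toℕ i) (toℕ j))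

  psum-ddiff-column : ∀ K (j : Fin n) m →
    psum (λ i → ddiff K i j) m ≡ columnPart K (toℕ j) (m ⊓ n) - columnPart K (toℕ j) 0
  psum-ddiff-column K j m =
    trans (psum-cong (λ i → ddiff-column K i j) m) (psum-telescope (columnPart K (toℕ j)) m)

  psum-ddiff-row : ∀ K (i : Fin n) m →
    psum (λ j → ddiff K i j) m ≡ rowPart K (toℕ i) (m ⊓ n) - rowPart K (toℕ i) 0
  psum-ddiff-row K i m = psum-telescope (rowPart K (toℕ i)) m

  ddiff-cong : ∀ K K′ → (∀ r c → r ℕ.≤ n → c ℕ.≤ n → K r c ≡ K′ r c) → ∀ i j → ddiff K i j ≡ ddiff K′ i j
  ddiff-cong K K′ K≡K′ i j = cong₂ _-_
    (cong₂ _-_ (K≡K′ _ _ (Fin.toℕ<n i) (Fin.toℕ<n j)) (K≡K′ _ _ (ℕ.<⇒≤ (Fin.toℕ<n i)) (Fin.toℕ<n j)))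
    (cong₂ _-_ (K≡K′ _ _ (Fin.toℕ<n i) (ℕ.<⇒≤ (Fin.toℕ<n j))) (K≡K′ _ _ (ℕ.<⇒≤ (Fin.toℕ<n i)) (ℕ.<⇒≤ (Fin.toℕ<n j))))

  record IsHeight (G : ℕ → ℕ → ℤ) : Set where
    field
      zero-left  : ∀ i j → i ℕ.< n → j ℕ.≤ i → G i j ≡ 0ℤ
      t-right    : ∀ i j → i ℕ.< n → end i ℕ.≤ j → j ℕ.≤ n → G i j ≡ + t
      within     : ∀ i j → i ℕ.< n → j ℕ.≤ n → Within (G i j)
      increasing : ∀ i j → i ℕ.< n → j ℕ.< n → G i j ≤ G i (suc j)
      decreasing : ∀ i j → suc i ℕ.< n → j ℕ.≤ n → G (suc i) j ≤ G i j

  cornerSums : (ℕ → ℕ → ℤ) → ℕ → ℕ → ℤ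
  cornerSums G zero    c = 0ℤ
  cornerSums G (suc r) c = + ((c ⊓ r) ℕ.* t) + G r c

  module HeightToMatrix (G : ℕ → ℕ → ℤ) (isHeight : IsHeight G) where
    open IsHeight isHeight

    K = cornerSums G

    K-left : ∀ r → r ℕ.≤ n → K r 0 ≡ 0ℤ
    K-left zero    _   = refl
    K-left (suc r) r<n = cong (_+_ 0ℤ) (zero-left r 0 r<n z≤n)

    columnPart-complete : ∀ j i → i ℕ.< n → j ℕ.< i → columnPart K j (suc i) ≡ + t
    columnPart-complete j i i<n j<i
      rewrite ℕ.m≤n⇒m⊓n≡m j<i | ℕ.m≤n⇒m⊓n≡m (ℕ.<⇒≤ j<i)
            | zero-left i (suc j) i<n j<i | zero-left i j i<n (ℕ.<⇒≤ j<i) | ℤ.pos-+ t (j ℕ.* t) =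
      solve 2 (λ t x → (t :+ x :+ con 0ℤ) :- (x :+ con 0ℤ) := t) refl (+ t) (+ (j ℕ.* t))

    columnPart-height : ∀ j i → i ℕ.≤ j → columnPart K j (suc i) ≡ G i (suc j) - G i j
    columnPart-height j i i≤j rewrite ℕ.m≥n⇒m⊓n≡n (ℕ.m≤n⇒m≤1+n i≤j) | ℕ.m≥n⇒m⊓n≡n i≤j =
      solve 3 (λ x a b → (x :+ a) :- (x :+ b) := a :- b) refl (+ (i ℕ.* t)) (G i (suc j)) (G i j)

    rowPart-first : ∀ c → rowPart K 0 c ≡ G 0 c
    rowPart-first c rewrite ℕ.⊓-zeroʳ c = solve 1 (λ a → (con 0ℤ :+ a) :- con 0ℤ := a) refl (G 0 c)

    rowPart-left : ∀ r c → suc r ℕ.< n → c ℕ.≤ r → rowPart K (suc r) c ≡ 0ℤ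
    rowPart-left r c 1+r<n c≤r
      rewrite ℕ.m≤n⇒m⊓n≡m c≤r | ℕ.m≤n⇒m⊓n≡m (ℕ.m≤n⇒m≤1+n c≤r)
            | zero-left r c (ℕ.<-trans (ℕ.n<1+n r) 1+r<n) c≤r | zero-left (suc r) c 1+r<n (ℕ.m≤n⇒m≤1+n c≤r) =
      solve 1 (λ x → (x :+ con 0ℤ) :- (x :+ con 0ℤ) := con 0ℤ) refl (+ (c ℕ.* t))

    rowPart-right : ∀ r c → r ℕ.< c → rowPart K (suc r) c ≡ + t + (G (suc r) c - G r c)
    rowPart-right r c r<c rewrite ℕ.m≥n⇒m⊓n≡n r<c | ℕ.m≥n⇒m⊓n≡n (ℕ.<⇒≤ r<c) | ℤ.pos-+ t (r ℕ.* t) =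
      solve 4 (λ t x a b → (t :+ x :+ a) :- (x :+ b) := t :+ (a :- b)) refl
        (+ t) (+ (r ℕ.* t)) (G (suc r) c) (G r c)

    rowPart-0 : ∀ i → i ℕ.< n → rowPart K i 0 ≡ 0ℤ
    rowPart-0 i i<n rewrite K-left (suc i) i<n | K-left i (ℕ.<⇒≤ i<n) = refl

    columnPart-within : ∀ j r → j ℕ.< n → r ℕ.≤ n → Within (columnPart K j r)
    columnPart-within j zero    _   _   = +≤+ z≤n , +≤+ z≤n
    columnPart-within j (suc i) j<n i<n with ℕ.<-≤-connex j i
    ... | inj₁ j<i rewrite columnPart-complete j i i<n j<i = +≤+ z≤n , ℤ.≤-refl
    ... | inj₂ i≤j rewrite columnPart-height j i i≤j =
      within-difference (increasing i j i<n j<n) (proj₁ (within i j i<n (ℕ.<⇒≤ j<n))) (proj₂ (within i (suc j) i<n j<n))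

    rowPart-within : ∀ i c → i ℕ.< n → c ℕ.≤ n → Within (rowPart K i c)
    rowPart-within zero    c i<n c≤n rewrite rowPart-first c = within 0 c i<n c≤n
    rowPart-within (suc r) c i<n c≤n with ℕ.≤-<-connex c r
    ... | inj₁ c≤r rewrite rowPart-left r c i<n c≤r = +≤+ z≤n , +≤+ z≤n
    ... | inj₂ r<c rewrite rowPart-right r c r<c =
      within-t+difference (proj₁ (within (suc r) c i<n c≤n)) (decreasing r c i<n c≤n)
        (proj₂ (within r c (ℕ.<⇒≤ i<n) c≤n))

    columnPart-last : ∀ j i → suc i ≡ n → j ℕ.≤ i → columnPart K j (suc i) ≡ + t
    columnPart-last j i 1+i≡n j≤i with ℕ.m≤n⇒m<n∨m≡n j≤i
    ... | inj₁ j<i  = columnPart-complete j i (subst (i ℕ.<_) 1+i≡n (ℕ.n<1+n i)) j<i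
    ... | inj₂ refl
      rewrite columnPart-height j j ℕ.≤-refl | zero-left j j (subst (j ℕ.<_) 1+i≡n (ℕ.n<1+n j)) ℕ.≤-refl
            | t-right j (suc j) (subst (j ℕ.<_) 1+i≡n (ℕ.n<1+n j)) (subst (end j ℕ.≤_) (sym 1+i≡n) (end≤n j))
                (ℕ.≤-reflexive 1+i≡n) = ℤ.+-identityʳ (+ t)

    rowPart-last : ∀ i → i ℕ.< n → rowPart K i n ≡ + t
    rowPart-last zero    0<n   rewrite rowPart-first n = t-right 0 n 0<n (end≤n 0) ℕ.≤-refl
    rowPart-last (suc r) 1+r<n rewrite rowPart-right r n (ℕ.<-trans (ℕ.n<1+n r) 1+r<n)
      | t-right (suc r) n 1+r<n (end≤n (suc r)) ℕ.≤-refl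
      | t-right r n (ℕ.<-trans (ℕ.n<1+n r) 1+r<n) (end≤n r) ℕ.≤-refl
      | ℤ.+-inverseʳ (+ t) = ℤ.+-identityʳ (+ t)

    columnPart-beyond-end : ∀ j i → i ℕ.< n → end i ℕ.≤ j → j ℕ.< n → columnPart K j (suc i) ≡ 0ℤ
    columnPart-beyond-end j i i<n end≤j j<n
      rewrite columnPart-height j i (ℕ.<⇒≤ (ℕ.<-≤-trans (i<end i i<n) end≤j))
            | t-right i (suc j) i<n (ℕ.m≤n⇒m≤1+n end≤j) j<n | t-right i j i<n end≤j (ℕ.<⇒≤ j<n) =
      ℤ.+-inverseʳ (+ t)

    columns-within : ∀ j m → Within (psum (λ i → ddiff K i j) m)
    columns-within j m = subst Within (sym (trans (psum-ddiff-column K j m) (ℤ.+-identityʳ _)))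
      (columnPart-within (toℕ j) (m ⊓ n) (Fin.toℕ<n j) (ℕ.m⊓n≤n m n))

    rows-within : ∀ i m → Within (psum (λ j → ddiff K i j) m)
    rows-within i m = subst Within (sym (trans (psum-ddiff-row K i m)
        (trans (cong (_-_ (rowPart K (toℕ i) (m ⊓ n))) (rowPart-0 (toℕ i) (Fin.toℕ<n i))) (ℤ.+-identityʳ _))))
      (rowPart-within (toℕ i) (m ⊓ n) (Fin.toℕ<n i) (ℕ.m⊓n≤n m n))

    columns-total : ∀ j → psum (λ i → ddiff K i j) n ≡ + t
    columns-total j = begin
      psum (λ i → ddiff K i j) n                    ≡⟨ psum-ddiff-column K j n ⟩
      columnPart K (toℕ j) (n ⊓ n) - 0ℤ             ≡⟨ ℤ.+-identityʳ _ ⟩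
      columnPart K (toℕ j) (n ⊓ n)                  ≡⟨ cong (columnPart K (toℕ j)) (trans (ℕ.⊓-idem n) (sym (ℕ.suc-pred n))) ⟩
      columnPart K (toℕ j) (suc (ℕ.pred n))          ≡⟨ columnPart-last (toℕ j) (ℕ.pred n) (ℕ.suc-pred n) (ℕ.<⇒≤pred (Fin.toℕ<n j)) ⟩
      + t                                           ∎
      where
        open ≡-Reasoning
        instance _ = ℕ.>-nonZero (ℕ.≤-<-trans z≤n (Fin.toℕ<n j))

    rows-total : ∀ i → psum (λ j → ddiff K i j) n ≡ + t
    rows-total i = begin
      psum (λ j → ddiff K i j) n                              ≡⟨ psum-ddiff-row K i n ⟩
      rowPart K (toℕ i) (n ⊓ n) - rowPart K (toℕ i) 0         ≡⟨ cong (_-_ (rowPart K (toℕ i) (n ⊓ n))) (rowPart-0 (toℕ i) (Fin.toℕ<n i)) ⟩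
      rowPart K (toℕ i) (n ⊓ n) - 0ℤ                          ≡⟨ ℤ.+-identityʳ _ ⟩
      rowPart K (toℕ i) (n ⊓ n)                               ≡⟨ cong (rowPart K (toℕ i)) (ℕ.⊓-idem n) ⟩
      rowPart K (toℕ i) n                                     ≡⟨ rowPart-last (toℕ i) (Fin.toℕ<n i) ⟩
      + t                                                     ∎
      where open ≡-Reasoning

    hessenberg : ∀ i j → toℕ j ℕ.+ 2 ℕ.≤ toℕ i → ddiff K i j ≡ 0ℤ
    hessenberg i j j+2≤i = trans (ddiff-column K i j)
      (go (toℕ i) (Fin.toℕ<n i) (subst (ℕ._≤ toℕ i) (ℕ.+-comm (toℕ j) 2) j+2≤i))
      where
        go : ∀ i → i ℕ.< n → suc (suc (toℕ j)) ℕ.≤ i → columnPart K (toℕ j) (suc i) - columnPart K (toℕ j) i ≡ 0ℤ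
        go (suc i) 1+i<n (s≤s j<i) = trans
          (cong₂ _-_ (columnPart-complete (toℕ j) (suc i) 1+i<n (ℕ.m≤n⇒m≤1+n j<i))
                     (columnPart-complete (toℕ j) i (ℕ.<-trans (ℕ.n<1+n i) 1+i<n) j<i))
          (ℤ.+-inverseʳ (+ t))

    vanishes-on-λ : ∀ i j → toℕ i ℕ.< toℕ j → InPart n λ′ i j → ddiff K i j ≡ 0ℤ
    vanishes-on-λ i j i<j end≤j = trans (ddiff-column K i j)
      (trans (cong (_- columnPart K (toℕ j) (toℕ i)) (columnPart-beyond-end (toℕ j) (toℕ i) (Fin.toℕ<n i) end≤j (Fin.toℕ<n j)))
        (go (toℕ i) (Fin.toℕ<n i) end≤j))
      where
        go : ∀ i → i ℕ.< n → end i ℕ.≤ toℕ j → 0ℤ - columnPart K (toℕ j) i ≡ 0ℤ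
        go zero    _   _     = refl
        go (suc r) i<n end≤j = cong (_-_ 0ℤ) (columnPart-beyond-end (toℕ j) r (ℕ.<-trans (ℕ.n<1+n r) i<n)
          (ℕ.≤-trans (end-monotone (ℕ.n≤1+n r)) end≤j) (Fin.toℕ<n j))

    inDilatedPolytope : InDilatedPolytope n λ′ t (ddiff K)
    inDilatedPolytope = columns-within , rows-within , columns-total , rows-total , hessenberg , vanishes-on-λ

  columnSum : IntMatrix n → Fin n → ℕ → ℤ
  columnSum a j r = psum (λ i → a i j) r

  rowSum : IntMatrix n → Fin n → ℕ → ℤ
  rowSum a i c = psum (λ j → a i j) c

  cornerSum : IntMatrix n → ℕ → ℕ → ℤ
  cornerSum a r c = psum (λ j → columnSum a j r) c

  -- Sum of the entries of a in rows ≤ i and columns < c, without the min(c, i) columns left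
  -- of the diagonal: those are complete (sum t) in rows ≤ i, as a vanishes below the subdiagonal.
  heightOf : IntMatrix n → ℕ → ℕ → ℤ
  heightOf a i c = cornerSum a (suc i) c - + ((c ⊓ i) ℕ.* t)

  cornerSum-suc-column : ∀ a r c (c<n : c ℕ.< n) → cornerSum a r (suc c) ≡ cornerSum a r c + columnSum a (fromℕ< c<n) r
  cornerSum-suc-column a r c = psum-suc (λ j → columnSum a j r) c

  cornerSum-suc-row : ∀ a i c (i<n : i ℕ.< n) → cornerSum a (suc i) c ≡ cornerSum a i c + rowSum a (fromℕ< i<n) c
  cornerSum-suc-row a i c i<n =
    trans (psum-cong (λ j → psum-suc (λ i′ → a i′ j) i i<n) c) (psum-+ (λ j → columnSum a j i) (a (fromℕ< i<n)) c)

  cornerSum-top : ∀ a c → cornerSum a 0 c ≡ 0ℤ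
  cornerSum-top a c = psum-zero (λ j → columnSum a j 0) c (λ j _ → psum-0 (λ i → a i j))

  cornerSum-left : ∀ a r → cornerSum a r 0 ≡ 0ℤ
  cornerSum-left a r = psum-0 (λ j → columnSum a j r)

  ddiff-cornerSum : ∀ a i j → ddiff (cornerSum a) i j ≡ a i j
  ddiff-cornerSum a i j = begin
    (cornerSum a (suc i′) (suc j′) - cornerSum a i′ (suc j′)) - (cornerSum a (suc i′) j′ - cornerSum a i′ j′)
      ≡⟨ cong₂ _-_ (next-row (suc j′)) (next-row j′) ⟩
    rowSum a i (suc j′) - rowSum a i j′
      ≡⟨ cong (_- rowSum a i j′) (psum-suc (a i) j′ (Fin.toℕ<n j)) ⟩
    (rowSum a i j′ + a i (fromℕ< (Fin.toℕ<n j))) - rowSum a i j′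
      ≡⟨ cong (λ k → (rowSum a i j′ + a i k) - rowSum a i j′) (Fin.fromℕ<-toℕ j (Fin.toℕ<n j)) ⟩
    (rowSum a i j′ + a i j) - rowSum a i j′
      ≡⟨ solve 2 (λ r x → (r :+ x) :- r := x) refl (rowSum a i j′) (a i j) ⟩
    a i j
      ∎
    where
      open ≡-Reasoning
      i′ = toℕ i
      j′ = toℕ j
      next-row : ∀ c → cornerSum a (suc i′) c - cornerSum a i′ c ≡ rowSum a i c
      next-row c = begin
        cornerSum a (suc i′) c - cornerSum a i′ c
          ≡⟨ cong (_- cornerSum a i′ c) (cornerSum-suc-row a i′ c (Fin.toℕ<n i)) ⟩
        (cornerSum a i′ c + rowSum a (fromℕ< (Fin.toℕ<n i)) c) - cornerSum a i′ c
          ≡⟨ solve 2 (λ p r → (p :+ r) :- p := r) refl (cornerSum a i′ c) (rowSum a (fromℕ< (Fin.toℕ<n i)) c) ⟩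
        rowSum a (fromℕ< (Fin.toℕ<n i)) c
          ≡⟨ cong (λ k → rowSum a k c) (Fin.fromℕ<-toℕ i (Fin.toℕ<n i)) ⟩
        rowSum a i c
          ∎

  module MatrixToHeight (a : IntMatrix n) (a∈ : InDilatedPolytope n λ′ t a) where

    columns-total : ∀ j → columnSum a j n ≡ + t
    columns-total = proj₁ (proj₂ (proj₂ a∈))

    rows-total : ∀ i → rowSum a i n ≡ + t
    rows-total = proj₁ (proj₂ (proj₂ (proj₂ a∈)))

    G = heightOf a

    columnSum-complete : ∀ j r → suc (suc (toℕ j)) ℕ.≤ r → columnSum a j r ≡ + t
    columnSum-complete j r 2+j≤r = trans
      (psum-tail-zero (λ i → a i j) r λ i r≤i →
        proj₁ (proj₂ (proj₂ (proj₂ (proj₂ a∈)))) i j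
          (subst (ℕ._≤ toℕ i) (ℕ.+-comm 2 (toℕ j)) (ℕ.≤-trans 2+j≤r r≤i)))
      (columns-total j)

    columnSum-beyond-end : ∀ j i → i ℕ.< n → end i ℕ.≤ toℕ j → columnSum a j (suc i) ≡ 0ℤ
    columnSum-beyond-end j i i<n end≤j = psum-zero (λ i′ → a i′ j) (suc i) λ i′ i′≤i →
      proj₂ (proj₂ (proj₂ (proj₂ (proj₂ a∈)))) i′ j
        (ℕ.<-≤-trans (ℕ.≤-<-trans (ℕ.≤-pred i′≤i) (i<end i i<n)) end≤j)
        (ℕ.≤-trans (end-monotone (ℕ.≤-pred i′≤i)) end≤j)

    cornerSum-complete : ∀ i c → c ℕ.≤ i → i ℕ.< n → cornerSum a (suc i) c ≡ + (c ℕ.* t)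
    cornerSum-complete i zero    _   _   = cornerSum-left a (suc i)
    cornerSum-complete i (suc c) c<i i<n = begin
      cornerSum a (suc i) (suc c)                          ≡⟨ cornerSum-suc-column a (suc i) c c<n ⟩
      cornerSum a (suc i) c + columnSum a (fromℕ< c<n) (suc i)
        ≡⟨ cong₂ _+_ (cornerSum-complete i c (ℕ.<⇒≤ c<i) i<n)
             (columnSum-complete (fromℕ< c<n) (suc i) (s≤s (subst (ℕ._< i) (sym (Fin.toℕ-fromℕ< c<n)) c<i))) ⟩
      + (c ℕ.* t) + + t                                    ≡⟨ trans (ℤ.+-comm (+ (c ℕ.* t)) (+ t)) (sym (ℤ.pos-+ t (c ℕ.* t))) ⟩
      + (suc c ℕ.* t)                                      ∎
      where
        open ≡-Reasoning
        c<n = ℕ.<-trans c<i i<n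

    cornerSum-rows : ∀ i → i ℕ.< n → cornerSum a (suc i) n ≡ + (suc i ℕ.* t)
    cornerSum-rows zero    0<n   = trans (cornerSum-suc-row a 0 n 0<n)
      (trans (cong₂ _+_ (cornerSum-top a n) (rows-total (fromℕ< 0<n))) (cong +_ (sym (ℕ.+-identityʳ t))))
    cornerSum-rows (suc i) 1+i<n = trans (cornerSum-suc-row a (suc i) n 1+i<n)
      (trans (cong₂ _+_ (cornerSum-rows i (ℕ.<-trans (ℕ.n<1+n i) 1+i<n)) (rows-total (fromℕ< 1+i<n)))
        (trans (ℤ.+-comm (+ (suc i ℕ.* t)) (+ t)) (sym (ℤ.pos-+ t (suc i ℕ.* t)))))

    zero-left : ∀ i c → i ℕ.< n → c ℕ.≤ i → G i c ≡ 0ℤ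
    zero-left i c i<n c≤i rewrite cornerSum-complete i c c≤i i<n | ℕ.m≤n⇒m⊓n≡m c≤i = ℤ.+-inverseʳ (+ (c ℕ.* t))

    last-column : ∀ i → i ℕ.< n → G i n ≡ + t
    last-column i i<n rewrite cornerSum-rows i i<n | ℕ.m≥n⇒m⊓n≡n (ℕ.<⇒≤ i<n) | ℤ.pos-+ t (i ℕ.* t) =
      solve 2 (λ t x → (t :+ x) :- x := t) refl (+ t) (+ (i ℕ.* t))

    t-right : ∀ i c → i ℕ.< n → end i ℕ.≤ c → c ℕ.≤ n → G i c ≡ + t
    t-right i c i<n end≤c c≤n = begin
      cornerSum a (suc i) c - + ((c ⊓ i) ℕ.* t)
        ≡⟨ cong₂ (λ x m → x - + (m ℕ.* t))
             (psum-tail-zero (λ j → columnSum a j (suc i)) c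
               (λ j c≤j → columnSum-beyond-end j i i<n (ℕ.≤-trans end≤c c≤j)))
             (ℕ.m≥n⇒m⊓n≡n (ℕ.≤-trans (ℕ.<⇒≤ (i<end i i<n)) end≤c)) ⟩
      cornerSum a (suc i) n - + (i ℕ.* t)
        ≡⟨ cong (λ m → cornerSum a (suc i) n - + (m ℕ.* t)) (ℕ.m≥n⇒m⊓n≡n (ℕ.<⇒≤ i<n)) ⟨
      G i n
        ≡⟨ last-column i i<n ⟩
      + t
        ∎
      where open ≡-Reasoning

    next-column : ∀ i c → i ℕ.≤ c → (c<n : c ℕ.< n) → G i (suc c) ≡ G i c + columnSum a (fromℕ< c<n) (suc i)
    next-column i c i≤c c<n rewrite cornerSum-suc-column a (suc i) c c<n
      | ℕ.m≥n⇒m⊓n≡n (ℕ.m≤n⇒m≤1+n i≤c) | ℕ.m≥n⇒m⊓n≡n i≤c =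
      solve 3 (λ p q x → (p :+ q) :- x := (p :- x) :+ q) refl
        (cornerSum a (suc i) c) (columnSum a (fromℕ< c<n) (suc i)) (+ (i ℕ.* t))

    next-row : ∀ i c (1+i<n : suc i ℕ.< n) → i ℕ.< c → G (suc i) c ≡ G i c + (rowSum a (fromℕ< 1+i<n) c - + t)
    next-row i c 1+i<n i<c rewrite cornerSum-suc-row a (suc i) c 1+i<n
      | ℕ.m≥n⇒m⊓n≡n i<c | ℕ.m≥n⇒m⊓n≡n (ℕ.<⇒≤ i<c) | ℤ.pos-+ t (i ℕ.* t) =
      solve 4 (λ p r t x → (p :+ r) :- (t :+ x) := (p :- x) :+ (r :- t)) refl
        (cornerSum a (suc i) c) (rowSum a (fromℕ< 1+i<n) c) (+ t) (+ (i ℕ.* t))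

    increasing : ∀ i c → i ℕ.< n → c ℕ.< n → G i c ≤ G i (suc c)
    increasing i c i<n c<n with ℕ.<-≤-connex c i
    ... | inj₁ c<i rewrite zero-left i c i<n (ℕ.<⇒≤ c<i) | zero-left i (suc c) i<n c<i = ℤ.≤-refl
    ... | inj₂ i≤c rewrite next-column i c i≤c c<n =
      subst (_≤ G i c + columnSum a (fromℕ< c<n) (suc i)) (ℤ.+-identityʳ (G i c))
        (ℤ.+-monoʳ-≤ (G i c) (proj₁ (proj₁ a∈ (fromℕ< c<n) (suc i))))

    within : ∀ i c → i ℕ.< n → c ℕ.≤ n → Within (G i c)
    within i c i<n c≤n =
      subst (_≤ G i c) (zero-left i 0 i<n z≤n) (monotone-chain (G i) (λ c′ c′<n → increasing i c′ i<n c′<n) z≤n c≤n) ,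
      subst (G i c ≤_) (last-column i i<n) (monotone-chain (G i) (λ c′ c′<n → increasing i c′ i<n c′<n) c≤n ℕ.≤-refl)

    decreasing : ∀ i c → suc i ℕ.< n → c ℕ.≤ n → G (suc i) c ≤ G i c
    decreasing i c 1+i<n c≤n with ℕ.≤-<-connex c i
    ... | inj₁ c≤i rewrite zero-left (suc i) c 1+i<n (ℕ.m≤n⇒m≤1+n c≤i)
                         | zero-left i c (ℕ.<-trans (ℕ.n<1+n i) 1+i<n) c≤i = ℤ.≤-refl
    ... | inj₂ i<c rewrite next-row i c 1+i<n i<c =
      subst (G i c + (rowSum a (fromℕ< 1+i<n) c - + t) ≤_) (ℤ.+-identityʳ (G i c))
        (ℤ.+-monoʳ-≤ (G i c) (ℤ.i≤j⇒i-j≤0 (proj₂ (proj₁ (proj₂ a∈) (fromℕ< 1+i<n) c))))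

    isHeight : IsHeight G
    isHeight = record
      { zero-left = zero-left ; t-right = t-right ; within = within
      ; increasing = increasing ; decreasing = decreasing }

  mapOf : (ℕ → ℕ → ℤ) → CellMap n
  mapOf G i j = suc ∣ G (toℕ i) (toℕ j) ∣

  module HeightToMap (G : ℕ → ℕ → ℤ) (isHeight : IsHeight G) where
    open IsHeight isHeight

    decreasing-chain : ∀ {i′ i j} → i′ ℕ.≤ i → i ℕ.< n → j ℕ.≤ n → G i j ≤ G i′ j
    decreasing-chain {i = zero}  z≤n  _   _   = ℤ.≤-refl
    decreasing-chain {i = suc i} i′≤i i<n j≤n with ℕ.m≤n⇒m<n∨m≡n i′≤i
    ... | inj₂ refl      = ℤ.≤-refl
    ... | inj₁ (s≤s i′≤) = ℤ.≤-trans (decreasing i _ i<n j≤n) (decreasing-chain i′≤ (ℕ.<-trans (ℕ.n<1+n i) i<n) j≤n)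

    ∣∣-mono : ∀ {x y} → 0ℤ ≤ x → x ≤ y → ∣ x ∣ ℕ.≤ ∣ y ∣
    ∣∣-mono (+≤+ _) (+≤+ m≤n) = m≤n

    orderPreserving : OrderPresInto n λ′ (suc t) (mapOf G)
    orderPreserving = bounds , monotone
      where
        bounds : ∀ i j → InPoset n λ′ i j → 1 ℕ.≤ mapOf G i j × mapOf G i j ℕ.≤ suc t
        bounds i j _ = let 0≤G , G≤t = within (toℕ i) (toℕ j) (Fin.toℕ<n i) (ℕ.<⇒≤ (Fin.toℕ<n j)) in
          s≤s z≤n , s≤s (∣∣-mono 0≤G G≤t)
        monotone : OrderPreserving n λ′ (mapOf G)
        monotone i j i′ j′ _ _ (i′≤i , j≤j′) = s≤s (∣∣-mono
          (proj₁ (within (toℕ i) (toℕ j) (Fin.toℕ<n i) (ℕ.<⇒≤ (Fin.toℕ<n j))))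
          (ℤ.≤-trans (monotone-chain (G (toℕ i)) (λ c c<n → increasing (toℕ i) c (Fin.toℕ<n i) c<n)
                        j≤j′ (ℕ.<⇒≤ (Fin.toℕ<n j′)))
                     (decreasing-chain i′≤i (Fin.toℕ<n i) (ℕ.<⇒≤ (Fin.toℕ<n j′)))))

  data Region (i j : ℕ) : Set where
    left   : j ℕ.≤ i → Region i j
    right  : i ℕ.< j → end i ℕ.≤ j → Region i j
    inside : (i<n : i ℕ.< n) (j<n : j ℕ.< n) → i ℕ.< j → j ℕ.< end i → Region i j

  region : ∀ i j → Region i j
  region i j with j ℕ.≤? i | end i ℕ.≤? j
  ... | yes j≤i | _         = left j≤i
  ... | no  j≰i | yes end≤j = right (ℕ.≰⇒> j≰i) end≤j
  ... | no  j≰i | no  end≰j =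
    inside (ℕ.<-trans (ℕ.≰⇒> j≰i) j<n) j<n (ℕ.≰⇒> j≰i) (ℕ.≰⇒> end≰j)
    where j<n = ℕ.<-≤-trans (ℕ.≰⇒> end≰j) (end≤n i)

  heightOfMap : CellMap n → ℕ → ℕ → ℕ
  heightOfMap g i j with region i j
  ... | left _                 = 0
  ... | right _ _              = t
  ... | inside i<n j<n _ _     = g (fromℕ< i<n) (fromℕ< j<n) ∸ 1

  inPoset-fromℕ< : ∀ {i j} (i<n : i ℕ.< n) (j<n : j ℕ.< n) → i ℕ.< j → j ℕ.< end i →
    InPoset n λ′ (fromℕ< i<n) (fromℕ< j<n)
  inPoset-fromℕ< i<n j<n i<j j<end rewrite Fin.toℕ-fromℕ< i<n | Fin.toℕ-fromℕ< j<n = i<j , j<end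

  module MapToHeight (g : CellMap n) (g-op : OrderPresInto n λ′ (suc t) g) where

    G : ℕ → ℕ → ℤ
    G i j = + heightOfMap g i j

    monotone : ∀ {i j i′ j′} (i<n : i ℕ.< n) (j<n : j ℕ.< n) (i′<n : i′ ℕ.< n) (j′<n : j′ ℕ.< n) →
      i ℕ.< j → j ℕ.< end i → i′ ℕ.< j′ → j′ ℕ.< end i′ → i′ ℕ.≤ i → j ℕ.≤ j′ →
      g (fromℕ< i<n) (fromℕ< j<n) ∸ 1 ℕ.≤ g (fromℕ< i′<n) (fromℕ< j′<n) ∸ 1
    monotone i<n j<n i′<n j′<n i<j j<end i′<j′ j′<end i′≤i j≤j′ = ℕ.∸-monoˡ-≤ 1
      (proj₂ g-op _ _ _ _ (inPoset-fromℕ< i<n j<n i<j j<end) (inPoset-fromℕ< i′<n j′<n i′<j′ j′<end)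
        (subst₂ ℕ._≤_ (sym (Fin.toℕ-fromℕ< i′<n)) (sym (Fin.toℕ-fromℕ< i<n)) i′≤i ,
         subst₂ ℕ._≤_ (sym (Fin.toℕ-fromℕ< j<n)) (sym (Fin.toℕ-fromℕ< j′<n)) j≤j′))

    bounded : ∀ {i j} (i<n : i ℕ.< n) (j<n : j ℕ.< n) → i ℕ.< j → j ℕ.< end i →
      g (fromℕ< i<n) (fromℕ< j<n) ∸ 1 ℕ.≤ t
    bounded i<n j<n i<j j<end = ℕ.∸-monoˡ-≤ 1 (proj₂ (proj₁ g-op _ _ (inPoset-fromℕ< i<n j<n i<j j<end)))

    height≤t : ∀ i j → heightOfMap g i j ℕ.≤ t
    height≤t i j with region i j
    ... | left _                 = z≤n
    ... | right _ _              = ℕ.≤-refl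
    ... | inside i<n j<n i<j j<end = bounded i<n j<n i<j j<end

    zero-left : ∀ i j → i ℕ.< n → j ℕ.≤ i → G i j ≡ 0ℤ
    zero-left i j _ j≤i with region i j
    ... | left _             = refl
    ... | right i<j _        = ⊥-elim (ℕ.<⇒≱ i<j j≤i)
    ... | inside _ _ i<j _   = ⊥-elim (ℕ.<⇒≱ i<j j≤i)

    t-right : ∀ i j → i ℕ.< n → end i ℕ.≤ j → j ℕ.≤ n → G i j ≡ + t
    t-right i j i<n end≤j _ with region i j
    ... | left j≤i           = ⊥-elim (ℕ.<⇒≱ (i<end i i<n) (ℕ.≤-trans end≤j j≤i))
    ... | right _ _          = refl
    ... | inside _ _ _ j<end = ⊥-elim (ℕ.<⇒≱ j<end end≤j)

    within : ∀ i j → i ℕ.< n → j ℕ.≤ n → Within (G i j)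
    within i j _ _ = +≤+ z≤n , +≤+ (height≤t i j)

    height-increasing : ∀ i j → heightOfMap g i j ℕ.≤ heightOfMap g i (suc j)
    height-increasing i j with region i j | region i (suc j)
    ... | left _             | _                   = z≤n
    ... | right i<j _        | left 1+j≤i          = ⊥-elim (ℕ.<⇒≱ i<j (ℕ.≤-trans (ℕ.n≤1+n j) 1+j≤i))
    ... | right _ _          | right _ _           = ℕ.≤-refl
    ... | right _ end≤j      | inside _ _ _ 1+j<end = ⊥-elim (ℕ.<⇒≱ 1+j<end (ℕ.m≤n⇒m≤1+n end≤j))
    ... | inside _ _ i<j _   | left 1+j≤i          = ⊥-elim (ℕ.<⇒≱ i<j (ℕ.≤-trans (ℕ.n≤1+n j) 1+j≤i))
    ... | inside i<n j<n i<j j<end | right _ _      = bounded i<n j<n i<j j<end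
    ... | inside i<n j<n i<j j<end | inside _ j′<n i<j′ j′<end =
      monotone i<n j<n i<n j′<n i<j j<end i<j′ j′<end ℕ.≤-refl (ℕ.n≤1+n j)

    height-decreasing : ∀ i j → heightOfMap g (suc i) j ℕ.≤ heightOfMap g i j
    height-decreasing i j with region (suc i) j | region i j
    ... | left _             | _                   = z≤n
    ... | right 1+i<j _      | left j≤i            = ⊥-elim (ℕ.<⇒≱ 1+i<j (ℕ.m≤n⇒m≤1+n j≤i))
    ... | right _ _          | right _ _           = ℕ.≤-refl
    ... | right _ end≤j      | inside _ _ _ j<end  = ⊥-elim (ℕ.<⇒≱ j<end (ℕ.≤-trans (end-monotone (ℕ.n≤1+n i)) end≤j))
    ... | inside _ _ 1+i<j _ | left j≤i            = ⊥-elim (ℕ.<⇒≱ 1+i<j (ℕ.m≤n⇒m≤1+n j≤i))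
    ... | inside 1+i<n j<n 1+i<j j<end | right _ _ = bounded 1+i<n j<n 1+i<j j<end
    ... | inside 1+i<n j<n 1+i<j j<end | inside i<n _ i<j j<end′ =
      monotone 1+i<n j<n i<n j<n 1+i<j j<end i<j j<end′ (ℕ.n≤1+n i) ℕ.≤-refl

    isHeight : IsHeight G
    isHeight = record
      { zero-left = zero-left ; t-right = t-right ; within = within
      ; increasing = λ i j _ _ → +≤+ (height-increasing i j)
      ; decreasing = λ i j _ _ → +≤+ (height-decreasing i j) }

  matrixOf : CellMap n → IntMatrix n
  matrixOf g = ddiff (cornerSums (λ i j → + heightOfMap g i j))

  cellMapOf : IntMatrix n → CellMap n
  cellMapOf a = mapOf (heightOf a)

  module _ (a : IntMatrix n) (a∈ : InDilatedPolytope n λ′ t a) where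
    open MatrixToHeight a a∈ using (zero-left; t-right; within)

    heightOfMap-cellMapOf : ∀ i c → i ℕ.< n → c ℕ.≤ n → + heightOfMap (cellMapOf a) i c ≡ heightOf a i c
    heightOfMap-cellMapOf i c i<n c≤n with region i c
    ... | left c≤i          = sym (zero-left i c i<n c≤i)
    ... | right _ end≤c     = sym (t-right i c i<n end≤c c≤n)
    ... | inside i<n′ c<n _ _ rewrite Fin.toℕ-fromℕ< i<n′ | Fin.toℕ-fromℕ< c<n =
      ℤ.0≤i⇒+∣i∣≡i (proj₁ (within i c i<n c≤n))

    matrixOf-cellMapOf : ∀ i j → matrixOf (cellMapOf a) i j ≡ a i j
    matrixOf-cellMapOf = λ i j → trans (ddiff-cong _ (cornerSum a) corners i j) (ddiff-cornerSum a i j)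
      where
        corners : ∀ r c → r ℕ.≤ n → c ℕ.≤ n → cornerSums (λ i j → + heightOfMap (cellMapOf a) i j) r c ≡ cornerSum a r c
        corners zero    c _   _   = sym (cornerSum-top a c)
        corners (suc i) c i<n c≤n = trans (cong (_+_ (+ ((c ⊓ i) ℕ.* t))) (heightOfMap-cellMapOf i c i<n c≤n))
          (solve 2 (λ x p → x :+ (p :- x) := p) refl (+ ((c ⊓ i) ℕ.* t)) (cornerSum a (suc i) c))

  module _ (g : CellMap n) (g-op : OrderPresInto n λ′ (suc t) g) where
    open MapToHeight g g-op using (G; isHeight)
    open HeightToMatrix G isHeight using (K; K-left)

    cornerSum-matrixOf : ∀ r c → r ℕ.≤ n → c ℕ.≤ n → cornerSum (matrixOf g) r c ≡ K r c
    cornerSum-matrixOf r c r≤n c≤n = begin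
      psum {n} (λ j → psum (λ i → ddiff K i j) r) c
        ≡⟨ psum-cong {n} (λ j → trans (psum-ddiff-column K j r)
             (trans (ℤ.+-identityʳ _) (cong (columnPart K (toℕ j)) (ℕ.m≤n⇒m⊓n≡m r≤n)))) c ⟩
      psum {n} (λ j → K r (suc (toℕ j)) - K r (toℕ j)) c
        ≡⟨ psum-telescope {n} (K r) c ⟩
      K r (c ⊓ n) - K r 0
        ≡⟨ cong₂ _-_ (cong (K r) (ℕ.m≤n⇒m⊓n≡m c≤n)) (K-left r r≤n) ⟩
      K r c - 0ℤ
        ≡⟨ ℤ.+-identityʳ _ ⟩
      K r c
        ∎
      where open ≡-Reasoning

    heightOf-matrixOf : ∀ i c → i ℕ.< n → c ℕ.≤ n → heightOf (matrixOf g) i c ≡ G i c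
    heightOf-matrixOf i c i<n c≤n = trans (cong (_- + ((c ⊓ i) ℕ.* t)) (cornerSum-matrixOf (suc i) c i<n c≤n))
      (solve 2 (λ x y → (x :+ y) :- x := y) refl (+ ((c ⊓ i) ℕ.* t)) (G i c))

    suc-heightOfMap : ∀ i j → InPoset n λ′ i j → suc (heightOfMap g (toℕ i) (toℕ j)) ≡ g i j
    suc-heightOfMap i j i∼j@(i<j , j<end) with region (toℕ i) (toℕ j)
    ... | left j≤i      = ⊥-elim (ℕ.<⇒≱ i<j j≤i)
    ... | right _ end≤j = ⊥-elim (ℕ.<⇒≱ j<end end≤j)
    ... | inside i<n j<n _ _ rewrite Fin.fromℕ<-toℕ i i<n | Fin.fromℕ<-toℕ j j<n =
      ℕ.suc-pred (g i j) {{ℕ.>-nonZero (proj₁ (proj₁ g-op i j i∼j))}}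

    cellMapOf-matrixOf : ∀ i j → InPoset n λ′ i j → g i j ≡ cellMapOf (matrixOf g) i j
    cellMapOf-matrixOf i j i∼j = sym (trans
      (cong (λ x → suc ∣ x ∣) (heightOf-matrixOf (toℕ i) (toℕ j) (Fin.toℕ<n i) (ℕ.<⇒≤ (Fin.toℕ<n j))))
      (suc-heightOfMap i j i∼j))

  cellMapOf-cong : ∀ {a a′} → a ≈M a′ → ∀ i j → cellMapOf a i j ≡ cellMapOf a′ i j
  cellMapOf-cong a≈a′ i j = cong (λ x → suc ∣ x - + ((toℕ j ⊓ toℕ i) ℕ.* t) ∣)
    (psum-cong (λ j′ → psum-cong (λ i′ → a≈a′ i′ j′) (suc (toℕ i))) (toℕ j))

  heightOfMap-cong : ∀ {g g′} → _≈on_ λ′ g g′ → ∀ i j → heightOfMap g i j ≡ heightOfMap g′ i j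
  heightOfMap-cong g≈g′ i j with region i j
  ... | left _                   = refl
  ... | right _ _                = refl
  ... | inside i<n j<n i<j j<end = cong (_∸ 1) (g≈g′ _ _ (inPoset-fromℕ< i<n j<n i<j j<end))

  matrixOf-cong : ∀ {g g′} → _≈on_ λ′ g g′ → matrixOf g ≈M matrixOf g′
  matrixOf-cong {g} {g′} g≈g′ =
    ddiff-cong (cornerSums (λ i j → + heightOfMap g i j)) (cornerSums (λ i j → + heightOfMap g′ i j)) λ where
    zero    c _ _ → refl
    (suc r) c _ _ → cong (λ h → + ((c ⊓ r) ℕ.* t) + + h) (heightOfMap-cong g≈g′ r c)

  ehrhartValue-from-Ω : ∀ {k} → Card (_≈on_ λ′) (OrderPresInto n λ′ (suc t)) k → EhrhartValue n λ′ t k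
  ehrhartValue-from-Ω = card-transfer (λ a≈b b≈c i j → trans (a≈b i j) (b≈c i j)) matrixOf cellMapOf
    (λ g g-op → HeightToMatrix.inDilatedPolytope _ (MapToHeight.isHeight g g-op))
    (λ a a∈ → HeightToMap.orderPreserving _ (MatrixToHeight.isHeight a a∈))
    matrixOf-cellMapOf
    (λ g g′ g-op g′-op eq i j i∼j → trans (cellMapOf-matrixOf g g-op i j i∼j)
      (trans (cellMapOf-cong eq i j) (sym (cellMapOf-matrixOf g′ g′-op i j i∼j))))
    (λ _ _ _ _ → matrixOf-cong)

module CellPoset (n : ℕ) (λ′ : List ℕ) where

  open import Defs
  open import Data.Nat as ℕ using (_≤?_; _<?_)
  import Data.Nat.Properties as ℕ
  open import Data.Fin using (Fin; toℕ)
  import Data.Fin as Fin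
  import Data.Fin.Properties as Fin
  open import Data.List using (filter; cartesianProduct; allFin; length)
  import Data.List.Relation.Unary.Any as Any
  open import Data.List.Relation.Unary.Unique.Propositional using (Unique)
  import Data.List.Relation.Unary.Unique.Propositional.Properties as Unique
  open import Data.List.Membership.Propositional using (_∈_)
  open import Data.List.Membership.Propositional.Properties
    using (∈-filter⁺; ∈-filter⁻; ∈-cartesianProduct⁺; ∈-allFin)
  open import Data.Product using (_×_; _,_; proj₂; uncurry; curry)
  open import Data.Product.Properties using (≡-dec; ,-injective)
  open import Relation.Binary.PropositionalEquality
  open import Relation.Nullary using (Dec)
  open import Relation.Nullary.Decidable using (_×-dec_)
  open Cardinality using (card-fromList; card-transfer)

  Cell : Set
  Cell = Fin n × Fin n

  _⊑_ : Cell → Cell → Set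
  (i , j) ⊑ (i′ , j′) = PLeq i j i′ j′

  _⊑?_ : ∀ c c′ → Dec (c ⊑ c′)
  (i , j) ⊑? (i′ , j′) = (toℕ i′ ℕ.≤? toℕ i) ×-dec (toℕ j ℕ.≤? toℕ j′)

  ⊑-trans : ∀ {c c′ c″} → c ⊑ c′ → c′ ⊑ c″ → c ⊑ c″
  ⊑-trans (i′≤i , j≤j′) (i″≤i′ , j′≤j″) = ℕ.≤-trans i″≤i′ i′≤i , ℕ.≤-trans j≤j′ j′≤j″

  ⊑-antisym : ∀ {c c′} → c ⊑ c′ → c′ ⊑ c → c ≡ c′
  ⊑-antisym (i′≤i , j≤j′) (i≤i′ , j′≤j) =
    cong₂ _,_ (Fin.toℕ-injective (ℕ.≤-antisym i≤i′ i′≤i)) (Fin.toℕ-injective (ℕ.≤-antisym j≤j′ j′≤j))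

  IsElement : Cell → Set
  IsElement (i , j) = InPoset n λ′ i j

  isElement? : ∀ c → Dec (IsElement c)
  isElement? (i , j) = (toℕ i ℕ.<? toℕ j) ×-dec (toℕ j ℕ.<? n ℕ.∸ part λ′ (toℕ i))

  elements : List Cell
  elements = filter isElement? (cartesianProduct (allFin n) (allFin n))

  elements-unique : Unique elements
  elements-unique = Unique.filter⁺ isElement? (Unique.cartesianProduct⁺ (Unique.allFin⁺ n) (Unique.allFin⁺ n))

  ∈-elements⁺ : ∀ {i j} → InPoset n λ′ i j → (i , j) ∈ elements
  ∈-elements⁺ {i} {j} = ∈-filter⁺ isElement? (∈-cartesianProduct⁺ (∈-allFin i) (∈-allFin j))

  ∈-elements⁻ : ∀ {c} → c ∈ elements → IsElement c
  ∈-elements⁻ c∈ = proj₂ (∈-filter⁻ isElement? {xs = cartesianProduct (allFin n) (allFin n)} c∈)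

  open OrderPreservingMaps (≡-dec Fin._≟_ Fin._≟_) _⊑?_ public
    renaming (OrderPreserving to OrderPreservingOn; LinearExtension to LinearExtensionOn)

  posetSize : PosetSize n λ′ (length elements)
  posetSize = card-fromList sym elements ∈-elements⁻ elements-unique
    (λ _ i∼j → Any.map sym (∈-elements⁺ i∼j))

  ≈on-trans : ∀ {g h k : CellMap n} → _≈on_ λ′ g h → _≈on_ λ′ h k → _≈on_ λ′ g k
  ≈on-trans g≈h h≈k i j i∼j = trans (g≈h i j i∼j) (h≈k i j i∼j)

  toCellMap : ∀ {m h} → OrderPreservingOn elements m h → OrderPresInto n λ′ m (curry h)
  toCellMap (bounded , monotone) =
    (λ i j i∼j → bounded (∈-elements⁺ i∼j)) ,
    (λ i j i′ j′ i∼j i′∼j′ → monotone (∈-elements⁺ i∼j) (∈-elements⁺ i′∼j′))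

  fromCellMap : ∀ {m g} → OrderPresInto n λ′ m g → OrderPreservingOn elements m (uncurry g)
  fromCellMap (bounded , monotone) =
    (λ c∈ → bounded _ _ (∈-elements⁻ c∈)) ,
    (λ c∈ c′∈ → monotone _ _ _ _ (∈-elements⁻ c∈) (∈-elements⁻ c′∈))

  transfer : ∀ {S : Labelling → Set} {T : CellMap n → Set} →
    (∀ {h} → S h → T (curry h)) → (∀ {g} → T g → S (uncurry g)) →
    ∀ {k} → Card (λ h h′ → h ≈[ elements ] h′) S k → Card (_≈on_ λ′) T k
  transfer S⇒T T⇒S = card-transfer ≈on-trans curry uncurry (λ _ → S⇒T) (λ _ → T⇒S)
    (λ _ _ _ _ _ → refl) (λ _ _ _ _ h≈h′ {_} c∈ → h≈h′ _ _ (∈-elements⁻ c∈))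
    (λ _ _ _ _ h≈h′ _ _ i∼j → h≈h′ (∈-elements⁺ i∼j))

  Ω-OmegaValue : ∀ m → OmegaValue n λ′ m (Ω elements m)
  Ω-OmegaValue m = transfer toCellMap fromCellMap (card-orderPreserving m elements-unique)

  surjCount-NumLinExt : NumLinExt n λ′ (surjCount elements (length elements))
  surjCount-NumLinExt = length elements , posetSize ,
    transfer (λ (op , injective) → toCellMap op , λ i j i′ j′ i∼j i′∼j′ eq →
               ,-injective (injective (∈-elements⁺ i∼j) (∈-elements⁺ i′∼j′) eq))
             (λ (op , injective) → fromCellMap op , λ c∈ c′∈ eq →
               let i≡ , j≡ = injective _ _ _ _ (∈-elements⁻ c∈) (∈-elements⁻ c′∈) eq in cong₂ _,_ i≡ j≡)
             (card-linearExtensions elements-unique)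

open import Data.Nat using (suc; _≤_; _*_)
open import Data.Nat.Combinatorics using (_C_)
open import Data.Nat.Properties using (≤-refl)
open import Data.List using (length)
open import Data.Product using (Σ; _×_; _,_; proj₁; proj₂)
open import Relation.Binary using (IsEquivalence)
open import Relation.Binary.PropositionalEquality using (_≡_; refl; sym; trans; cong; module ≡-Reasoning)
open import Defs using (NumLinExt; NormalizedVolume; EhrhartValue; OmegaValue; ℕtoℚ; evalPoly; _≈M_)
open Cardinality using (card-unique)
open BinomialPolynomials using (binomialSum-polynomial)
open NatSums using (sumUpTo)

≈M-isEquivalence : ∀ {n} → IsEquivalence (_≈M_ {n})
≈M-isEquivalence = record
  { refl  = λ _ _ → refl
  ; sym   = λ a≈b i j → sym (a≈b i j)
  ; trans = λ a≈b b≈c i j → trans (a≈b i j) (b≈c i j) }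

module _ (n : ℕ) (λ′ : List ℕ) (λ⊆δ : IsPartitionIn n λ′) where
  open CellPoset n λ′

  ehrhartValue : ∀ t → EhrhartValue n λ′ t (Ω elements (suc t))
  ehrhartValue t = LatticePoints.ehrhartValue-from-Ω n λ′ t λ⊆δ (Ω-OmegaValue (suc t))

  normalizedVolume : NormalizedVolume n λ′ (surjCount elements (length elements))
  normalizedVolume = length elements , c , last≢0 , ehrhart-c , leading
    where
      polynomial = binomialSum-polynomial (surjCount elements) (length elements)
        (surjCount-positive ⊑-trans ⊑-antisym (length elements) elements-unique refl)
      c = proj₁ polynomial
      last≢0 = proj₁ (proj₂ polynomial)
      leading = proj₂ (proj₂ (proj₂ polynomial))
      ehrhart-c : ∀ t k → EhrhartValue n λ′ t k → ℕtoℚ k ≡ evalPoly c (ℕtoℚ t)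
      ehrhart-c t k k-value = begin
        ℕtoℚ k
          ≡⟨ cong ℕtoℚ (card-unique ≈M-isEquivalence k-value (ehrhartValue t)) ⟩
        ℕtoℚ (Ω elements (suc t))
          ≡⟨ cong ℕtoℚ (Ω≡∑surjCount*C (suc (length elements)) (suc t) elements ≤-refl) ⟩
        ℕtoℚ (∑[ s < suc (length elements) ] (surjCount elements s * (suc t C s)))
          ≡⟨ proj₁ (proj₂ (proj₂ polynomial)) t ⟩
        evalPoly c (ℕtoℚ t)
          ∎
        where open ≡-Reasoning

corollary4p7 : (n : ℕ) (λ′ : List ℕ) → 1 ≤ n → IsPartitionIn n λ′ →
    (Σ ℕ λ e → NumLinExt n λ′ e × NormalizedVolume n λ′ e) ×
    (∀ t → Σ ℕ λ k → EhrhartValue n λ′ t k × OmegaValue n λ′ (suc t) k)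
corollary4p7 n λ′ _ λ⊆δ =
  (surjCount elements (length elements) , surjCount-NumLinExt , normalizedVolume n λ′ λ⊆δ) ,
  λ t → Ω elements (suc t) , ehrhartValue n λ′ λ⊆δ t , Ω-OmegaValue (suc t)
  where open CellPoset n λ′
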